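{- Let $G$ be a simple undirected graph with $n\ge 0$ vertices of degrees $k_1,\dots,k_n$ and $m\ge 0$ edges, and write $n\langle k^2\rangle=\sum_{i=1}^n k_i^2$. Under a uniformly random linear arrangement of the vertices, the second moment about zero of the sum of edge lengths $D$ is $$\mathbb{E}_{rla}[D^2]=\frac{n+1}{45}\left[m\bigl(m(5n+4)+2(n-1)\bigr)+\left(\frac n4-1\right)n\langle k^2\rangle\right].$$
   Context: A linear arrangement of the vertex set $V$ ($|V|=n$) is a bijection $\pi:V\to\{1,\dots,n\}$; the length of an edge $\{u,v\}$ is $|\pi(u)-\pi(v)|$; $D$ is the sum of the lengths of all edges. In a uniformly random linear arrangement $\pi$ is uniform over all $n!$ bijections, and $\mathbb{E}_{rla}$ is the corresponding expectation. $\langle k^2\rangle=\frac1n\sum_i k_i^2$ is the second moment of the degree; the product $n\langle k^2\rangle$ is always interpreted as $\sum_i k_i^2$ (so it is defined also for $n=0$). -}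

module Defs where

open import Data.Bool using (Bool; true; false; if_then_else_; T)
open import Data.Nat as ℕ using (ℕ; zero; suc; _+_; _*_; _^_; ∣_-_∣; _<ᵇ_)
open import Data.Fin as Fin using (Fin; toℕ)
open import Data.Nat.ListAction using (sum)
open import Data.List using (List; []; _∷_; map; allFin; length; concatMap; filter)
open import Data.Vec as Vec using (Vec; lookup; toList)
import Data.List.Relation.Unary.Unique.DecPropositional as UDP
open import Data.Integer using (+_)
open import Data.Rational using (ℚ; _/_; 0ℚ)
open import Relation.Binary.PropositionalEquality using (_≡_)

record SimpleGraph (n : ℕ) : Set where
  field
    adj     : Fin n → Fin n → Bool
    sym     : ∀ i j → adj i j ≡ adj j i
    irrefl  : ∀ i → adj i i ≡ false
open SimpleGraph public

Σ[_] : (n : ℕ) → (Fin n → ℕ) → ℕ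
Σ[ n ] f = sum (map f (allFin n))

ind : Bool → ℕ
ind true  = 1
ind false = 0

degree : ∀ {n} → SimpleGraph n → Fin n → ℕ
degree {n} G i = Σ[ n ] (λ j → ind (adj G i j))

edgeCount : ∀ {n} → SimpleGraph n → ℕ
edgeCount {n} G = Σ[ n ] (λ i → Σ[ n ] (λ j →
  ind (toℕ i <ᵇ toℕ j) * ind (adj G i j)))

sumSqDeg : ∀ {n} → SimpleGraph n → ℕ
sumSqDeg {n} G = Σ[ n ] (λ i → degree G i ^ 2)

allVecs : (n k : ℕ) → List (Vec (Fin n) k)
allVecs n zero    = Vec.[] ∷ []
allVecs n (suc k) = concatMap (λ x → map (x Vec.∷_) (allVecs n k)) (allFin n)

-- All linear arrangements: injective (hence bijective) maps
-- vertex i ↦ position (lookup π i), positions 0..n-1 (shift of 1..n,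
-- irrelevant for edge lengths).
arrangements : (n : ℕ) → List (Vec (Fin n) n)
arrangements n = filter (λ v → UDP.unique? (Fin._≟_ {n}) (toList v)) (allVecs n n)

sumEdgeLengths : ∀ {n} → SimpleGraph n → Vec (Fin n) n → ℕ
sumEdgeLengths {n} G π = Σ[ n ] (λ i → Σ[ n ] (λ j →
  ind (toℕ i <ᵇ toℕ j) * ind (adj G i j) *
  ∣ toℕ (lookup π i) - toℕ (lookup π j) ∣))

average : List ℕ → ℚ
average xs with length xs
... | zero  = 0ℚ
... | suc l = (+ sum xs) / suc l

Erla : (n : ℕ) → (Vec (Fin n) n → ℕ) → ℚ
Erla n f = average (map f (arrangements n))

module Submission where

-- D² is a sum over ordered pairs of edges of d(i,j)·d(k,l), so E[D²] is a combination of three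
-- expectations: for two equal edges, for two edges sharing one vertex and for two disjoint edges,
-- taken m, Σk² − 2m and m² + m − Σk² times.  Precomposing arrangements with a transposition only
-- permutes them, so a k-point expectation is unchanged when one vertex is replaced by any vertex
-- outside the others; summing over that vertex expresses it through a (k−1)-point expectation.
-- Descending this way reduces the three values to sums of |x−y|, |x−y|² and (Σ_y |x−y|)² over
-- positions x, y < n, which Faulhaber's formulas evaluate.

module ListSums where

  open import Data.Nat as ℕ using (ℕ; _+_; _*_; _≤_; z≤n)
  import Data.Nat.Properties as ℕ
  open import Data.Nat.ListAction using (sum)
  open import Data.Nat.ListAction.Properties using (sum-↭)
  open import Data.List using (List; []; _∷_; map; length)
  import Data.List.Properties as List
  open import Data.List.Membership.Propositional using (_∈_)
  open import Data.List.Relation.Unary.Any using (here; there)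
  open import Data.List.Relation.Binary.Permutation.Propositional using (_↭_)
  import Data.List.Relation.Binary.Permutation.Propositional.Properties as ↭
  open import Function using (_∘_)
  open import Relation.Binary.PropositionalEquality
  open import Data.Nat.Tactic.RingSolver using (solve-∀)

  private variable A B : Set

  ∑ : List A → (A → ℕ) → ℕ
  ∑ xs f = sum (map f xs)

  syntax ∑ xs (λ x → e) = ∑[ x ∈ xs ] e

  ∑-cong-∈ : ∀ (xs : List A) {f g : A → ℕ} → (∀ {x} → x ∈ xs → f x ≡ g x) → ∑ xs f ≡ ∑ xs g
  ∑-cong-∈ []       eq = refl
  ∑-cong-∈ (x ∷ xs) eq = cong₂ _+_ (eq (here refl)) (∑-cong-∈ xs (eq ∘ there))

  ∑-cong : ∀ (xs : List A) {f g : A → ℕ} → (∀ x → f x ≡ g x) → ∑ xs f ≡ ∑ xs g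
  ∑-cong xs eq = ∑-cong-∈ xs (λ {x} _ → eq x)

  ∑-zero : ∀ (xs : List A) → ∑[ _ ∈ xs ] 0 ≡ 0
  ∑-zero []       = refl
  ∑-zero (x ∷ xs) = ∑-zero xs

  ∑-const : ∀ (xs : List A) c → ∑[ _ ∈ xs ] c ≡ length xs * c
  ∑-const []       c = refl
  ∑-const (x ∷ xs) c = cong (c +_) (∑-const xs c)

  ∑-+ : ∀ (xs : List A) (f g : A → ℕ) → ∑[ x ∈ xs ] (f x + g x) ≡ ∑ xs f + ∑ xs g
  ∑-+ []       f g = refl
  ∑-+ (x ∷ xs) f g = trans (cong (f x + g x +_) (∑-+ xs f g)) (interchange (f x) (g x) _ _)
    where
    interchange : ∀ a b c d → (a + b) + (c + d) ≡ (a + c) + (b + d)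
    interchange = solve-∀

  ∑-*ˡ : ∀ (xs : List A) c (f : A → ℕ) → ∑[ x ∈ xs ] (c * f x) ≡ c * ∑ xs f
  ∑-*ˡ []       c f = sym (ℕ.*-zeroʳ c)
  ∑-*ˡ (x ∷ xs) c f = trans (cong (c * f x +_) (∑-*ˡ xs c f)) (sym (ℕ.*-distribˡ-+ c (f x) (∑ xs f)))

  ∑-*ʳ : ∀ (xs : List A) c (f : A → ℕ) → ∑[ x ∈ xs ] (f x * c) ≡ ∑ xs f * c
  ∑-*ʳ xs c f = trans (∑-cong xs (λ x → ℕ.*-comm (f x) c)) (trans (∑-*ˡ xs c f) (ℕ.*-comm c (∑ xs f)))

  ∑-comm : ∀ (xs : List A) (ys : List B) (f : A → B → ℕ) →
           ∑[ x ∈ xs ] ∑[ y ∈ ys ] f x y ≡ ∑[ y ∈ ys ] ∑[ x ∈ xs ] f x y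
  ∑-comm []       ys f = sym (∑-zero ys)
  ∑-comm (x ∷ xs) ys f = trans (cong (∑ ys (f x) +_) (∑-comm xs ys f)) (sym (∑-+ ys (f x) _))

  ∑-map : ∀ (xs : List A) (g : A → B) (f : B → ℕ) → ∑ (map g xs) f ≡ ∑ xs (f ∘ g)
  ∑-map xs g f = cong sum (sym (List.map-∘ xs))

  ∑-↭ : ∀ {xs ys : List A} (f : A → ℕ) → xs ↭ ys → ∑ xs f ≡ ∑ ys f
  ∑-↭ f p = sum-↭ (↭.map⁺ f p)

  ∑-mono : ∀ (xs : List A) {f g : A → ℕ} → (∀ x → f x ≤ g x) → ∑ xs f ≤ ∑ xs g
  ∑-mono []       le = z≤n
  ∑-mono (x ∷ xs) le = ℕ.+-mono-≤ (le x) (∑-mono xs le)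

module FinSums where

  open import Defs using (Σ[_]; ind)
  open ListSums
  open import Data.Nat.Tactic.RingSolver using (solve-∀)
  open import Data.Nat as ℕ using (ℕ; zero; suc; _+_; _*_; _≤_; z≤n)
  import Data.Nat.Properties as ℕ
  open import Data.Fin as Fin using (Fin)
  open import Data.List using (List; []; _∷_; allFin; length)
  open import Data.List.Membership.Propositional using (_∈_; _∉_)
  import Data.List.Membership.DecPropositional as DecMembership
  open import Data.Nat.ListAction using (sum)
  open import Data.List.Relation.Unary.Any using (here; there)
  import Data.List.Relation.Unary.All as All
  open import Data.List.Relation.Unary.AllPairs using (_∷_)
  open import Data.List.Relation.Unary.Unique.Propositional using (Unique)
  import Data.List.Properties as List
  open import Function using (_∘_)
  open import Relation.Nullary using (yes; no; does)
  open import Relation.Nullary.Decidable using (dec-true; dec-false)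
  open import Relation.Binary.PropositionalEquality
  open ≡-Reasoning

  private variable n : ℕ

  δ : Fin n → Fin n → ℕ
  δ x y = ind (does (x Fin.≟ y))

  δ-refl : ∀ (x : Fin n) → δ x x ≡ 1
  δ-refl x rewrite dec-true (x Fin.≟ x) refl = refl

  δ-≢ : ∀ {x y : Fin n} → x ≢ y → δ x y ≡ 0
  δ-≢ {x = x} {y} x≢y rewrite dec-false (x Fin.≟ y) x≢y = refl

  Σ-suc : ∀ n (f : Fin (suc n) → ℕ) → Σ[ suc n ] f ≡ f Fin.zero + Σ[ n ] (f ∘ Fin.suc)
  Σ-suc n f = cong (λ xs → f Fin.zero + sum xs)
    (trans (List.map-tabulate Fin.suc f) (sym (List.map-tabulate (λ x → x) (f ∘ Fin.suc))))

  Σ-δ : ∀ n (y : Fin n) (g : Fin n → ℕ) → Σ[ n ] (λ x → δ x y * g x) ≡ g y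
  Σ-δ (suc n) Fin.zero    g = begin
    Σ[ suc n ] (λ x → δ x Fin.zero * g x)                   ≡⟨ Σ-suc n (λ x → δ x Fin.zero * g x) ⟩
    g Fin.zero + 0 + Σ[ n ] (λ x → 0 * g (Fin.suc x))         ≡⟨ cong₂ _+_ (ℕ.+-identityʳ _) (∑-zero (allFin n)) ⟩
    g Fin.zero + 0                                          ≡⟨ ℕ.+-identityʳ _ ⟩
    g Fin.zero                                              ∎
  Σ-δ (suc n) (Fin.suc y) g = trans (Σ-suc n (λ x → δ x (Fin.suc y) * g x)) (Σ-δ n y (g ∘ Fin.suc))

  Σ² : ∀ n → (Fin n → Fin n → ℕ) → ℕ
  Σ² n F = Σ[ n ] (λ k → Σ[ n ] (F k))

  Σ²-δδ : ∀ n (F : Fin n → Fin n → ℕ) i j → Σ² n (λ k l → F k l * (δ k i * δ l j)) ≡ F i j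
  Σ²-δδ n F i j = begin
    Σ² n (λ k l → F k l * (δ k i * δ l j))   ≡⟨ ∑-cong (allFin n) (λ k → ∑-cong (allFin n) (λ l → reorder (F k l) (δ k i) (δ l j))) ⟩
    Σ² n (λ k l → δ k i * (δ l j * F k l))   ≡⟨ ∑-cong (allFin n) (λ k → trans (∑-*ˡ (allFin n) (δ k i) _) (cong (δ k i *_) (Σ-δ n j (F k)))) ⟩
    Σ[ n ] (λ k → δ k i * F k j)             ≡⟨ Σ-δ n i (λ k → F k j) ⟩
    F i j                                    ∎
    where reorder : ∀ f a b → f * (a * b) ≡ a * (b * f)
          reorder = solve-∀

  Σ²-*ˡ : ∀ n c (F : Fin n → Fin n → ℕ) → Σ² n (λ k l → c * F k l) ≡ c * Σ² n F
  Σ²-*ˡ n c F = trans (∑-cong (allFin n) (λ k → ∑-*ˡ (allFin n) c (F k))) (∑-*ˡ (allFin n) c _)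

  Σ²-+ : ∀ n (F H : Fin n → Fin n → ℕ) → Σ² n (λ k l → F k l + H k l) ≡ Σ² n F + Σ² n H
  Σ²-+ n F H = trans (∑-cong (allFin n) (λ k → ∑-+ (allFin n) (F k) (H k)))
                     (∑-+ (allFin n) (λ k → Σ[ n ] (F k)) (λ k → Σ[ n ] (H k)))

  Σ⁴ : ∀ n → (Fin n → Fin n → Fin n → Fin n → ℕ) → ℕ
  Σ⁴ n F = Σ² n (λ i j → Σ² n (F i j))

  Σ⁴-cong : ∀ {n} {F H : Fin n → Fin n → Fin n → Fin n → ℕ} → (∀ i j k l → F i j k l ≡ H i j k l) → Σ⁴ n F ≡ Σ⁴ n H
  Σ⁴-cong {n} eq = ∑-cong (allFin n) (λ i → ∑-cong (allFin n) (λ j → ∑-cong (allFin n) (λ k → ∑-cong (allFin n) (eq i j k))))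

  Σ⁴-+ : ∀ {n} (F H : Fin n → Fin n → Fin n → Fin n → ℕ) → Σ⁴ n (λ i j k l → F i j k l + H i j k l) ≡ Σ⁴ n F + Σ⁴ n H
  Σ⁴-+ {n} F H = begin
    Σ⁴ n (λ i j k l → F i j k l + H i j k l)
      ≡⟨ ∑-cong (allFin n) (λ i → ∑-cong (allFin n) (λ j → Σ²-+ n (F i j) (H i j))) ⟩
    Σ² n (λ i j → Σ² n (F i j) + Σ² n (H i j))
      ≡⟨ Σ²-+ n (λ i j → Σ² n (F i j)) (λ i j → Σ² n (H i j)) ⟩
    Σ⁴ n F + Σ⁴ n H ∎

  Σ⁴-*ˡ : ∀ {n} c (F : Fin n → Fin n → Fin n → Fin n → ℕ) → Σ⁴ n (λ i j k l → c * F i j k l) ≡ c * Σ⁴ n F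
  Σ⁴-*ˡ {n} c F = trans (∑-cong (allFin n) (λ i → ∑-cong (allFin n) (λ j → Σ²-*ˡ n c (F i j))))
                        (Σ²-*ˡ n c (λ i j → Σ² n (F i j)))

  Σ⁴-linear : ∀ {n} a b c (F H J : Fin n → Fin n → Fin n → Fin n → ℕ) →
              Σ⁴ n (λ i j k l → a * F i j k l + b * H i j k l + c * J i j k l) ≡ a * Σ⁴ n F + b * Σ⁴ n H + c * Σ⁴ n J
  Σ⁴-linear a b c F H J = trans (Σ⁴-+ (λ i j k l → a * F i j k l + b * H i j k l) (λ i j k l → c * J i j k l))
    (cong₂ _+_ (trans (Σ⁴-+ (λ i j k l → a * F i j k l) (λ i j k l → b * H i j k l)) (cong₂ _+_ (Σ⁴-*ˡ a F) (Σ⁴-*ˡ b H)))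
               (Σ⁴-*ˡ c J))

  multiplicity : List (Fin n) → Fin n → ℕ
  multiplicity ys x = ∑[ y ∈ ys ] δ x y

  multiplicity-∉ : ∀ (ys : List (Fin n)) {x} → x ∉ ys → multiplicity ys x ≡ 0
  multiplicity-∉ []       _   = refl
  multiplicity-∉ (y ∷ ys) x∉ = cong₂ _+_ (δ-≢ (x∉ ∘ here)) (multiplicity-∉ ys (x∉ ∘ there))

  multiplicity-∈ : ∀ {ys : List (Fin n)} {x} → Unique ys → x ∈ ys → multiplicity ys x ≡ 1
  multiplicity-∈ {ys = y ∷ ys} (y∉ys ∷ _) (here refl) =
    cong₂ _+_ (δ-refl y) (multiplicity-∉ ys (λ y∈ → All.lookup y∉ys y∈ refl))
  multiplicity-∈ {ys = y ∷ ys} (y∉ys ∷ u) (there x∈) =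
    cong₂ _+_ (δ-≢ (λ x≡y → All.lookup y∉ys x∈ (sym x≡y))) (multiplicity-∈ u x∈)

  Σ-multiplicity : ∀ n (ys : List (Fin n)) (g : Fin n → ℕ) → Σ[ n ] (λ x → multiplicity ys x * g x) ≡ ∑ ys g
  Σ-multiplicity n ys g = begin
    Σ[ n ] (λ x → multiplicity ys x * g x)        ≡⟨ ∑-cong (allFin n) (λ x → sym (∑-*ʳ ys (g x) (δ x))) ⟩
    Σ[ n ] (λ x → ∑[ y ∈ ys ] (δ x y * g x))     ≡⟨ ∑-comm (allFin n) ys _ ⟩
    ∑[ y ∈ ys ] Σ[ n ] (λ x → δ x y * g x)       ≡⟨ ∑-cong ys (λ y → Σ-δ n y g) ⟩
    ∑ ys g                                       ∎

  Σ-const : ∀ n c → Σ[ n ] (λ _ → c) ≡ n * c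
  Σ-const n c = trans (∑-const (allFin n) c) (cong (_* c) (List.length-tabulate {n = n} (λ x → x)))

  Σ-constant-outside : ∀ n (ys : List (Fin n)) → Unique ys → (F : Fin n → ℕ) (c : Fin n) →
                   (∀ x → x ∉ ys → F x ≡ F c) → Σ[ n ] F + length ys * F c ≡ n * F c + ∑ ys F
  Σ-constant-outside n ys u F c off = begin
    Σ[ n ] F + length ys * F c
      ≡⟨ cong (Σ[ n ] F +_) (trans (sym (∑-const ys (F c))) (sym (Σ-multiplicity n ys (λ _ → F c)))) ⟩
    Σ[ n ] F + Σ[ n ] (λ x → multiplicity ys x * F c)        ≡⟨ ∑-+ (allFin n) F _ ⟨
    Σ[ n ] (λ x → F x + multiplicity ys x * F c)             ≡⟨ ∑-cong (allFin n) swap ⟩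
    Σ[ n ] (λ x → F c + multiplicity ys x * F x)             ≡⟨ ∑-+ (allFin n) (λ _ → F c) _ ⟩
    Σ[ n ] (λ _ → F c) + Σ[ n ] (λ x → multiplicity ys x * F x) ≡⟨ cong₂ _+_ (Σ-const n (F c)) (Σ-multiplicity n ys F) ⟩
    n * F c + ∑ ys F                                          ∎
    where
    swap : ∀ x → F x + multiplicity ys x * F c ≡ F c + multiplicity ys x * F x
    swap x with DecMembership._∈?_ Fin._≟_ x ys
    ... | yes x∈ rewrite multiplicity-∈ u x∈ = trans (cong (F x +_) (ℕ.*-identityˡ (F c)))
                                                     (trans (ℕ.+-comm (F x) (F c)) (cong (F c +_) (sym (ℕ.*-identityˡ (F x)))))
    ... | no  x∉ rewrite multiplicity-∉ ys x∉ = cong (_+ 0) (off x x∉)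

  unique-length≤ : ∀ n (ys : List (Fin n)) → Unique ys → length ys ≤ n
  unique-length≤ n ys u = subst₂ _≤_ counted all (∑-mono (allFin n) at-most-once)
    where
    counted : Σ[ n ] (λ x → multiplicity ys x * 1) ≡ length ys
    counted = trans (Σ-multiplicity n ys (λ _ → 1)) (trans (∑-const ys 1) (ℕ.*-identityʳ (length ys)))
    all : Σ[ n ] (λ _ → 1) ≡ n
    all = trans (Σ-const n 1) (ℕ.*-identityʳ n)
    at-most-once : ∀ x → multiplicity ys x * 1 ≤ 1
    at-most-once x with DecMembership._∈?_ Fin._≟_ x ys
    ... | yes x∈ rewrite multiplicity-∈ u x∈ = ℕ.≤-refl
    ... | no  x∉ rewrite multiplicity-∉ ys x∉ = z≤n

module PowerSums where

  open import Data.Nat as ℕ using (ℕ; zero; suc)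
  import Data.Nat.Properties as ℕ
  open import Data.Integer as ℤ using (ℤ; +_; -_; _+_; _*_; _-_)
  import Data.Integer.Properties as ℤ
  open import Data.Integer.Tactic.RingSolver using (solve-∀)
  open import Relation.Binary.PropositionalEquality
  open ≡-Reasoning

  pos-suc : ∀ n → + suc n ≡ + n + + 1
  pos-suc n = trans (cong +_ (ℕ.+-comm 1 n)) (ℤ.pos-+ n 1)

  ∑< : ℕ → (ℕ → ℤ) → ℤ
  ∑< zero    f = + 0
  ∑< (suc n) f = ∑< n f + f n

  syntax ∑< n (λ y → e) = ∑[ y < n ] e

  ∑<-cong : ∀ n {f g : ℕ → ℤ} → (∀ y → y ℕ.< n → f y ≡ g y) → ∑< n f ≡ ∑< n g
  ∑<-cong zero    eq = refl
  ∑<-cong (suc n) eq = cong₂ _+_ (∑<-cong n (λ y y<n → eq y (ℕ.m≤n⇒m≤1+n y<n))) (eq n ℕ.≤-refl)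

  ∑<-*ˡ : ∀ n c (f : ℕ → ℤ) → ∑[ y < n ] (c * f y) ≡ c * ∑< n f
  ∑<-*ˡ zero    c f = sym (ℤ.*-zeroʳ c)
  ∑<-*ˡ (suc n) c f = trans (cong (_+ c * f n) (∑<-*ˡ n c f)) (sym (ℤ.*-distribˡ-+ c (∑< n f) (f n)))

  ∑<-front : ∀ n (f : ℕ → ℤ) → ∑< (suc n) f ≡ f 0 + ∑[ y < n ] f (suc y)
  ∑<-front zero    f = ℤ.+-comm (+ 0) (f 0)
  ∑<-front (suc n) f = trans (cong (_+ f (suc n)) (∑<-front n f)) (ℤ.+-assoc (f 0) _ _)

  ∑-antidifference : ∀ (f F : ℤ → ℤ) → F (+ 0) ≡ + 0 → (∀ y → F (y + + 1) ≡ F y + f y) →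
                     ∀ n → ∑[ y < n ] f (+ y) ≡ F (+ n)
  ∑-antidifference f F F0 ΔF zero    = sym F0
  ∑-antidifference f F F0 ΔF (suc n) = begin
    ∑[ y < n ] f (+ y) + f (+ n) ≡⟨ cong (_+ f (+ n)) (∑-antidifference f F F0 ΔF n) ⟩
    F (+ n) + f (+ n)            ≡⟨ sym (ΔF (+ n)) ⟩
    F (+ n + + 1)                ≡⟨ cong F (sym (pos-suc n)) ⟩
    F (+ suc n)                  ∎

  S₁ S₂ S₃ S₄ : ℕ → ℤ
  S₁ n = ∑[ y < n ] (+ y)
  S₂ n = ∑[ y < n ] (+ y * + y)
  S₃ n = ∑[ y < n ] (+ y * + y * + y)
  S₄ n = ∑[ y < n ] (+ y * + y * + y * + y)

  module _ (n : ℕ) where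
    private N = + n

    S₁-closed : + 2 * S₁ n ≡ N * (N - + 1)
    S₁-closed = trans (sym (∑<-*ˡ n (+ 2) _))
      (∑-antidifference _ (λ Y → Y * (Y - + 1)) refl step n)
      where step : ∀ Y → (Y + + 1) * (Y + + 1 - + 1) ≡ Y * (Y - + 1) + + 2 * Y
            step = solve-∀

    S₂-closed : + 6 * S₂ n ≡ (N - + 1) * N * (+ 2 * N - + 1)
    S₂-closed = trans (sym (∑<-*ˡ n (+ 6) _))
      (∑-antidifference _ (λ Y → (Y - + 1) * Y * (+ 2 * Y - + 1)) refl step n)
      where step : ∀ Y → (Y + + 1 - + 1) * (Y + + 1) * (+ 2 * (Y + + 1) - + 1)
                         ≡ (Y - + 1) * Y * (+ 2 * Y - + 1) + + 6 * (Y * Y)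
            step = solve-∀

    S₃-closed : + 4 * S₃ n ≡ N * N * (N - + 1) * (N - + 1)
    S₃-closed = trans (sym (∑<-*ˡ n (+ 4) _))
      (∑-antidifference _ (λ Y → Y * Y * (Y - + 1) * (Y - + 1)) refl step n)
      where step : ∀ Y → (Y + + 1) * (Y + + 1) * (Y + + 1 - + 1) * (Y + + 1 - + 1)
                         ≡ Y * Y * (Y - + 1) * (Y - + 1) + + 4 * (Y * Y * Y)
            step = solve-∀

    S₄-closed : + 30 * S₄ n ≡ (N - + 1) * N * (+ 2 * N - + 1) * (+ 3 * N * N - + 3 * N - + 1)
    S₄-closed = trans (sym (∑<-*ˡ n (+ 30) _))
      (∑-antidifference _ (λ Y → (Y - + 1) * Y * (+ 2 * Y - + 1) * (+ 3 * Y * Y - + 3 * Y - + 1)) refl step n)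
      where step : ∀ Y → (Y + + 1 - + 1) * (Y + + 1) * (+ 2 * (Y + + 1) - + 1) * (+ 3 * (Y + + 1) * (Y + + 1) - + 3 * (Y + + 1) - + 1)
                         ≡ (Y - + 1) * Y * (+ 2 * Y - + 1) * (+ 3 * Y * Y - + 3 * Y - + 1) + + 30 * (Y * Y * Y * Y)
            step = solve-∀

  quartic : (a b c d e : ℤ) → ℤ → ℤ
  quartic a b c d e y = a + b * y + c * (y * y) + d * (y * y * y) + e * (y * y * y * y)

  ∑-quartic : ∀ n a b c d e → ∑[ y < n ] quartic a b c d e (+ y)
              ≡ a * + n + b * S₁ n + c * S₂ n + d * S₃ n + e * S₄ n
  ∑-quartic zero    a b c d e = sym (zeros a b c d e)
    where zeros : ∀ a b c d e → a * + 0 + b * + 0 + c * + 0 + d * + 0 + e * + 0 ≡ + 0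
          zeros = solve-∀
  ∑-quartic (suc n) a b c d e = begin
    ∑[ y < n ] quartic a b c d e (+ y) + quartic a b c d e (+ n)
      ≡⟨ cong (_+ quartic a b c d e (+ n)) (∑-quartic n a b c d e) ⟩
    a * + n + b * S₁ n + c * S₂ n + d * S₃ n + e * S₄ n + quartic a b c d e (+ n)
      ≡⟨ step a b c d e (+ n) (S₁ n) (S₂ n) (S₃ n) (S₄ n) ⟩
    a * (+ n + + 1) + b * S₁ (suc n) + c * S₂ (suc n) + d * S₃ (suc n) + e * S₄ (suc n)
      ≡⟨ cong (λ M → a * M + b * S₁ (suc n) + c * S₂ (suc n) + d * S₃ (suc n) + e * S₄ (suc n)) (sym (pos-suc n)) ⟩
    a * + suc n + b * S₁ (suc n) + c * S₂ (suc n) + d * S₃ (suc n) + e * S₄ (suc n) ∎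
    where
    step : ∀ a b c d e Y s₁ s₂ s₃ s₄ →
           a * Y + b * s₁ + c * s₂ + d * s₃ + e * s₄ + (a + b * Y + c * (Y * Y) + d * (Y * Y * Y) + e * (Y * Y * Y * Y))
           ≡ a * (Y + + 1) + b * (s₁ + Y) + c * (s₂ + Y * Y) + d * (s₃ + Y * Y * Y) + e * (s₄ + Y * Y * Y * Y)
    step = solve-∀

  ∑-quartic-closed : ∀ n a b c d e → let N = + n in
    + 60 * ∑[ y < n ] quartic a b c d e (+ y)
    ≡ + 60 * a * N + + 30 * b * (N * (N - + 1)) + + 10 * c * ((N - + 1) * N * (+ 2 * N - + 1))
      + + 15 * d * (N * N * (N - + 1) * (N - + 1))
      + + 2 * e * ((N - + 1) * N * (+ 2 * N - + 1) * (+ 3 * N * N - + 3 * N - + 1))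
  ∑-quartic-closed n a b c d e = begin
    + 60 * ∑[ y < n ] quartic a b c d e (+ y)                       ≡⟨ cong (+ 60 *_) (∑-quartic n a b c d e) ⟩
    + 60 * (a * N + b * S₁ n + c * S₂ n + d * S₃ n + e * S₄ n)        ≡⟨ regroup a b c d e N (S₁ n) (S₂ n) (S₃ n) (S₄ n) ⟩
    + 60 * a * N + + 30 * b * (+ 2 * S₁ n) + + 10 * c * (+ 6 * S₂ n)
      + + 15 * d * (+ 4 * S₃ n) + + 2 * e * (+ 30 * S₄ n)
      ≡⟨ cong₂ (λ s₁ s₂ → + 60 * a * N + + 30 * b * s₁ + + 10 * c * s₂ + + 15 * d * (+ 4 * S₃ n) + + 2 * e * (+ 30 * S₄ n))
               (S₁-closed n) (S₂-closed n) ⟩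
    + 60 * a * N + + 30 * b * (N * (N - + 1)) + + 10 * c * ((N - + 1) * N * (+ 2 * N - + 1))
      + + 15 * d * (+ 4 * S₃ n) + + 2 * e * (+ 30 * S₄ n)
      ≡⟨ cong₂ (λ s₃ s₄ → + 60 * a * N + + 30 * b * (N * (N - + 1)) + + 10 * c * ((N - + 1) * N * (+ 2 * N - + 1))
                          + + 15 * d * s₃ + + 2 * e * s₄)
               (S₃-closed n) (S₄-closed n) ⟩
    + 60 * a * N + + 30 * b * (N * (N - + 1)) + + 10 * c * ((N - + 1) * N * (+ 2 * N - + 1))
      + + 15 * d * (N * N * (N - + 1) * (N - + 1))
      + + 2 * e * ((N - + 1) * N * (+ 2 * N - + 1) * (+ 3 * N * N - + 3 * N - + 1)) ∎
    where
    N = + n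
    regroup : ∀ a b c d e N s₁ s₂ s₃ s₄ →
              + 60 * (a * N + b * s₁ + c * s₂ + d * s₃ + e * s₄)
              ≡ + 60 * a * N + + 30 * b * (+ 2 * s₁) + + 10 * c * (+ 6 * s₂) + + 15 * d * (+ 4 * s₃) + + 2 * e * (+ 30 * s₄)
    regroup = solve-∀

module DistanceSums where

  open import Defs using (Σ[_])
  open ListSums
  open FinSums using (Σ-suc)
  open PowerSums
  open import Data.Nat as ℕ using (ℕ; zero; suc; _≤_; ∣_-_∣)
  import Data.Nat.Properties as ℕ
  open import Data.Integer as ℤ using (+_; -_; _+_; _*_; _-_)
  import Data.Integer.Properties as ℤ
  open import Data.Integer.Tactic.RingSolver using (solve-∀)
  open import Data.Fin using (toℕ)
  open import Data.Sum using (inj₁; inj₂)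
  open import Function using (_∘_)
  open import Relation.Binary.PropositionalEquality
  open ≡-Reasoning

  ∣-∣-≥ : ∀ {x y} → y ≤ x → + ∣ x - y ∣ ≡ + x - + y
  ∣-∣-≥ {x} {y} y≤x = trans (cong +_ (ℕ.m≤n⇒∣n-m∣≡n∸m y≤x))
    (trans (sym (ℤ.⊖-≥ y≤x)) (sym (ℤ.[+m]-[+n]≡m⊖n x y)))

  ∣-∣-≤ : ∀ {x y} → x ≤ y → + ∣ x - y ∣ ≡ + y - + x
  ∣-∣-≤ {x} {y} x≤y = trans (cong +_ (ℕ.∣-∣-comm x y)) (∣-∣-≥ x≤y)

  module _ (x : ℕ) where
    private X = + x

    ∑dist-beyond : ∀ n → n ≤ x → + 2 * (∑[ y < n ] (+ ∣ x - y ∣)) ≡ + 2 * + n * X - + n * + n + + n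
    ∑dist-beyond zero    _   = refl
    ∑dist-beyond (suc n) n<x = begin
      + 2 * (∑[ y < n ] (+ ∣ x - y ∣) + + ∣ x - n ∣)     ≡⟨ ℤ.*-distribˡ-+ (+ 2) (∑[ y < n ] (+ ∣ x - y ∣)) _ ⟩
      + 2 * (∑[ y < n ] (+ ∣ x - y ∣)) + + 2 * + ∣ x - n ∣ ≡⟨ cong₂ (λ a b → a + + 2 * b) (∑dist-beyond n (ℕ.<⇒≤ n<x)) (∣-∣-≥ (ℕ.<⇒≤ n<x)) ⟩
      + 2 * N * X - N * N + N + + 2 * (X - N)          ≡⟨ step N X ⟩
      + 2 * (N + + 1) * X - (N + + 1) * (N + + 1) + (N + + 1) ≡⟨ cong (λ M → + 2 * M * X - M * M + M) (sym (pos-suc n)) ⟩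
      + 2 * + suc n * X - + suc n * + suc n + + suc n  ∎
      where
      N = + n
      step : ∀ N X → + 2 * N * X - N * N + N + + 2 * (X - N) ≡ + 2 * (N + + 1) * X - (N + + 1) * (N + + 1) + (N + + 1)
      step = solve-∀

    ∑dist-within : ∀ n → x ≤ n → + 2 * (∑[ y < n ] (+ ∣ x - y ∣))
                          ≡ + 2 * X * X - + 2 * (+ n - + 1) * X + + n * + n - + n
    ∑dist-within zero    ℕ.z≤n = refl
    ∑dist-within (suc n) x≤1+n with ℕ.m≤n⇒m<n∨m≡n x≤1+n
    ... | inj₁ x<1+n = begin
      + 2 * (∑[ y < n ] (+ ∣ x - y ∣) + + ∣ x - n ∣)      ≡⟨ ℤ.*-distribˡ-+ (+ 2) (∑[ y < n ] (+ ∣ x - y ∣)) _ ⟩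
      + 2 * (∑[ y < n ] (+ ∣ x - y ∣)) + + 2 * + ∣ x - n ∣ ≡⟨ cong₂ (λ a b → a + + 2 * b) (∑dist-within n x≤n) (∣-∣-≤ x≤n) ⟩
      + 2 * X * X - + 2 * (N - + 1) * X + N * N - N + + 2 * (N - X) ≡⟨ step N X ⟩
      + 2 * X * X - + 2 * (N + + 1 - + 1) * X + (N + + 1) * (N + + 1) - (N + + 1)
        ≡⟨ cong (λ M → + 2 * X * X - + 2 * (M - + 1) * X + M * M - M) (sym (pos-suc n)) ⟩
      + 2 * X * X - + 2 * (+ suc n - + 1) * X + + suc n * + suc n - + suc n ∎
      where
      N = + n
      x≤n = ℕ.s≤s⁻¹ x<1+n
      step : ∀ N X → + 2 * X * X - + 2 * (N - + 1) * X + N * N - N + + 2 * (N - X)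
                     ≡ + 2 * X * X - + 2 * (N + + 1 - + 1) * X + (N + + 1) * (N + + 1) - (N + + 1)
      step = solve-∀
    ... | inj₂ refl = trans (∑dist-beyond (suc n) ℕ.≤-refl) (boundary X)
      where
      boundary : ∀ X → + 2 * X * X - X * X + X ≡ + 2 * X * X - + 2 * (X - + 1) * X + X * X - X
      boundary = solve-∀

  pos-Σ : ∀ n (g : ℕ → ℕ) → + Σ[ n ] (λ y → g (toℕ y)) ≡ ∑[ y < n ] (+ g y)
  pos-Σ zero    g = refl
  pos-Σ (suc n) g = begin
    + Σ[ suc n ] (λ y → g (toℕ y))           ≡⟨ cong +_ (Σ-suc n (λ y → g (toℕ y))) ⟩
    + (g 0 ℕ.+ Σ[ n ] (λ y → g (suc (toℕ y)))) ≡⟨ ℤ.pos-+ (g 0) _ ⟩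
    + g 0 + + Σ[ n ] (λ y → g (suc (toℕ y)))  ≡⟨ cong (λ s → + g 0 + s) (pos-Σ n (g ∘ suc)) ⟩
    + g 0 + ∑[ y < n ] (+ g (suc y))          ≡⟨ sym (∑<-front n (λ y → + g y)) ⟩
    ∑[ y < suc n ] (+ g y)                    ∎

  distSum : ℕ → ℕ → ℕ
  distSum n x = Σ[ n ] (λ y → ∣ x - toℕ y ∣)

  distSum-closed : ∀ {n x} → x ℕ.≤ n → let N = + n; X = + x in
                   + 2 * + distSum n x ≡ + 2 * X * X - + 2 * (N - + 1) * X + N * N - N
  distSum-closed {n} {x} x≤n = trans (cong (+ 2 *_) (pos-Σ n (λ y → ∣ x - y ∣))) (∑dist-within x n x≤n)

  pos-∣-∣² : ∀ x y → + (∣ x - y ∣ ℕ.* ∣ x - y ∣) ≡ (+ x - + y) * (+ x - + y)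
  pos-∣-∣² x y with ℕ.≤-total y x
  ... | inj₁ y≤x = trans (ℤ.pos-* ∣ x - y ∣ ∣ x - y ∣) (cong (λ z → z * z) (∣-∣-≥ y≤x))
  ... | inj₂ x≤y = trans (ℤ.pos-* ∣ x - y ∣ ∣ x - y ∣) (trans (cong (λ z → z * z) (∣-∣-≤ x≤y)) (flip (+ x) (+ y)))
    where flip : ∀ X Y → (Y - X) * (Y - X) ≡ (X - Y) * (X - Y)
          flip = solve-∀

  totalDist : ℕ → ℕ
  totalDist n = Σ[ n ] (λ x → distSum n (toℕ x))

  totalDist-closed : ∀ n → let N = + n in + 3 * + totalDist n ≡ (N - + 1) * N * (N + + 1)
  totalDist-closed n = ℤ.*-cancelˡ-≡ (+ 40) _ _ (begin
    + 40 * (+ 3 * + totalDist n)                             ≡⟨ rescale (+ totalDist n) ⟩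
    + 60 * (+ 2 * + totalDist n)                             ≡⟨ cong (λ t → + 60 * (+ 2 * t)) (pos-Σ n (distSum n)) ⟩
    + 60 * (+ 2 * ∑[ x < n ] (+ distSum n x))                ≡⟨ cong (+ 60 *_) (∑<-*ˡ n (+ 2) _) ⟨
    + 60 * ∑[ x < n ] (+ 2 * + distSum n x)                  ≡⟨ cong (+ 60 *_) (∑<-cong n pointwise) ⟩
    + 60 * ∑[ x < n ] quartic (N * N - N) (- (+ 2 * (N - + 1))) (+ 2) (+ 0) (+ 0) (+ x)
                                                             ≡⟨ ∑-quartic-closed n (N * N - N) (- (+ 2 * (N - + 1))) (+ 2) (+ 0) (+ 0) ⟩
    _                                                        ≡⟨ simplify N ⟩
    + 40 * ((N - + 1) * N * (N + + 1))                       ∎)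
    where
    N = + n
    rescale : ∀ t → + 40 * (+ 3 * t) ≡ + 60 * (+ 2 * t)
    rescale = solve-∀
    pointwise : ∀ x → x ℕ.< n → + 2 * + distSum n x ≡ quartic (N * N - N) (- (+ 2 * (N - + 1))) (+ 2) (+ 0) (+ 0) (+ x)
    pointwise x x<n = trans (distSum-closed (ℕ.<⇒≤ x<n)) (expand N (+ x))
      where expand : ∀ N X → + 2 * X * X - + 2 * (N - + 1) * X + N * N - N
                             ≡ (N * N - N) + (- (+ 2 * (N - + 1))) * X + + 2 * (X * X) + + 0 * (X * X * X) + + 0 * (X * X * X * X)
            expand = solve-∀
    simplify : ∀ N → + 60 * (N * N - N) * N + + 30 * (- (+ 2 * (N - + 1))) * (N * (N - + 1))
                     + + 10 * + 2 * ((N - + 1) * N * (+ 2 * N - + 1))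
                     + + 15 * + 0 * (N * N * (N - + 1) * (N - + 1))
                     + + 2 * + 0 * ((N - + 1) * N * (+ 2 * N - + 1) * (+ 3 * N * N - + 3 * N - + 1))
                     ≡ + 40 * ((N - + 1) * N * (N + + 1))
    simplify = solve-∀

  distSqSum : ℕ → ℕ → ℕ
  distSqSum n x = Σ[ n ] (λ y → ∣ x - toℕ y ∣ ℕ.* ∣ x - toℕ y ∣)

  distSqSum-closed : ∀ n x → let N = + n; X = + x in
    + 60 * + distSqSum n x
    ≡ quartic (+ 10 * ((N - + 1) * N * (+ 2 * N - + 1))) (- (+ 60 * (N * (N - + 1)))) (+ 60 * N) (+ 0) (+ 0) X
  distSqSum-closed n x = begin
    + 60 * + distSqSum n x                                ≡⟨ cong (+ 60 *_) (pos-Σ n (λ y → ∣ x - y ∣ ℕ.* ∣ x - y ∣)) ⟩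
    + 60 * ∑[ y < n ] (+ (∣ x - y ∣ ℕ.* ∣ x - y ∣))      ≡⟨ cong (+ 60 *_) (∑<-cong n (λ y _ → trans (pos-∣-∣² x y) (expand X (+ y)))) ⟩
    + 60 * ∑[ y < n ] quartic (X * X) (- (+ 2 * X)) (+ 1) (+ 0) (+ 0) (+ y)
                                                          ≡⟨ ∑-quartic-closed n (X * X) (- (+ 2 * X)) (+ 1) (+ 0) (+ 0) ⟩
    _                                                     ≡⟨ simplify N X ⟩
    quartic (+ 10 * ((N - + 1) * N * (+ 2 * N - + 1))) (- (+ 60 * (N * (N - + 1)))) (+ 60 * N) (+ 0) (+ 0) X ∎
    where
    N = + n
    X = + x
    expand : ∀ X Y → (X - Y) * (X - Y) ≡ X * X + (- (+ 2 * X)) * Y + + 1 * (Y * Y) + + 0 * (Y * Y * Y) + + 0 * (Y * Y * Y * Y)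
    expand = solve-∀
    simplify : ∀ N X →
      + 60 * (X * X) * N + + 30 * (- (+ 2 * X)) * (N * (N - + 1)) + + 10 * + 1 * ((N - + 1) * N * (+ 2 * N - + 1))
        + + 15 * + 0 * (N * N * (N - + 1) * (N - + 1))
        + + 2 * + 0 * ((N - + 1) * N * (+ 2 * N - + 1) * (+ 3 * N * N - + 3 * N - + 1))
      ≡ + 10 * ((N - + 1) * N * (+ 2 * N - + 1)) + (- (+ 60 * (N * (N - + 1)))) * X + + 60 * N * (X * X)
        + + 0 * (X * X * X) + + 0 * (X * X * X * X)
    simplify = solve-∀

  totalDistSq : ℕ → ℕ
  totalDistSq n = Σ[ n ] (λ x → distSqSum n (toℕ x))

  totalDistSq-closed : ∀ n → let N = + n in + 6 * + totalDistSq n ≡ N * N * (N - + 1) * (N + + 1)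
  totalDistSq-closed n = ℤ.*-cancelˡ-≡ (+ 600) _ _ (begin
    + 600 * (+ 6 * + totalDistSq n)                    ≡⟨ rescale (+ totalDistSq n) ⟩
    + 60 * (+ 60 * + totalDistSq n)                    ≡⟨ cong (λ t → + 60 * (+ 60 * t)) (pos-Σ n (distSqSum n)) ⟩
    + 60 * (+ 60 * ∑[ x < n ] (+ distSqSum n x))       ≡⟨ cong (+ 60 *_) (∑<-*ˡ n (+ 60) _) ⟨
    + 60 * ∑[ x < n ] (+ 60 * + distSqSum n x)         ≡⟨ cong (+ 60 *_) (∑<-cong n (λ x _ → distSqSum-closed n x)) ⟩
    + 60 * ∑[ x < n ] quartic a b c (+ 0) (+ 0) (+ x)   ≡⟨ ∑-quartic-closed n a b c (+ 0) (+ 0) ⟩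
    _                                                  ≡⟨ simplify N ⟩
    + 600 * (N * N * (N - + 1) * (N + + 1))            ∎)
    where
    N = + n
    a = + 10 * ((N - + 1) * N * (+ 2 * N - + 1))
    b = - (+ 60 * (N * (N - + 1)))
    c = + 60 * N
    rescale : ∀ t → + 600 * (+ 6 * t) ≡ + 60 * (+ 60 * t)
    rescale = solve-∀
    simplify : ∀ N →
      + 60 * (+ 10 * ((N - + 1) * N * (+ 2 * N - + 1))) * N + + 30 * (- (+ 60 * (N * (N - + 1)))) * (N * (N - + 1))
        + + 10 * (+ 60 * N) * ((N - + 1) * N * (+ 2 * N - + 1))
        + + 15 * + 0 * (N * N * (N - + 1) * (N - + 1))
        + + 2 * + 0 * ((N - + 1) * N * (+ 2 * N - + 1) * (+ 3 * N * N - + 3 * N - + 1))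
      ≡ + 600 * (N * N * (N - + 1) * (N + + 1))
    simplify = solve-∀

  distSum²-closed : ∀ {n x} → x ℕ.≤ n → let N = + n; β = - (+ 2 * (N - + 1)); c₀ = N * N - N in
    + 4 * + (distSum n x ℕ.* distSum n x) ≡ quartic (c₀ * c₀) (+ 2 * β * c₀) (β * β + + 4 * c₀) (+ 4 * β) (+ 4) (+ x)
  distSum²-closed {n} {x} x≤n = begin
    + 4 * + (distSum n x ℕ.* distSum n x)         ≡⟨ cong (+ 4 *_) (ℤ.pos-* (distSum n x) (distSum n x)) ⟩
    + 4 * (+ distSum n x * + distSum n x)         ≡⟨ double² (+ distSum n x) ⟩
    (+ 2 * + distSum n x) * (+ 2 * + distSum n x) ≡⟨ cong (λ z → z * z) (distSum-closed x≤n) ⟩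
    _                                             ≡⟨ expand (+ n) (+ x) ⟩
    _                                             ∎
    where
    double² : ∀ z → + 4 * (z * z) ≡ (+ 2 * z) * (+ 2 * z)
    double² = solve-∀
    expand : ∀ N X →
      (+ 2 * X * X - + 2 * (N - + 1) * X + N * N - N) * (+ 2 * X * X - + 2 * (N - + 1) * X + N * N - N)
      ≡ (N * N - N) * (N * N - N) + + 2 * (- (+ 2 * (N - + 1))) * (N * N - N) * X
        + ((- (+ 2 * (N - + 1))) * (- (+ 2 * (N - + 1))) + + 4 * (N * N - N)) * (X * X)
        + + 4 * (- (+ 2 * (N - + 1))) * (X * X * X) + + 4 * (X * X * X * X)
    expand = solve-∀

  totalDistSumSq : ℕ → ℕ
  totalDistSumSq n = Σ[ n ] (λ x → distSum n (toℕ x) ℕ.* distSum n (toℕ x))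

  totalDistSumSq-closed : ∀ n → let N = + n in
    + 60 * + totalDistSumSq n ≡ N * (N * N - + 1) * (+ 7 * N * N - + 8)
  totalDistSumSq-closed n = ℤ.*-cancelˡ-≡ (+ 4) _ _ (begin
    + 4 * (+ 60 * + totalDistSumSq n)                   ≡⟨ rescale (+ totalDistSumSq n) ⟩
    + 60 * (+ 4 * + totalDistSumSq n)                   ≡⟨ cong (λ t → + 60 * (+ 4 * t)) (pos-Σ n (λ x → distSum n x ℕ.* distSum n x)) ⟩
    + 60 * (+ 4 * ∑[ x < n ] (+ (distSum n x ℕ.* distSum n x))) ≡⟨ cong (+ 60 *_) (∑<-*ˡ n (+ 4) _) ⟨
    + 60 * ∑[ x < n ] (+ 4 * + (distSum n x ℕ.* distSum n x))
      ≡⟨ cong (+ 60 *_) (∑<-cong n (λ x x<n → distSum²-closed (ℕ.<⇒≤ x<n))) ⟩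
    + 60 * ∑[ x < n ] quartic (c₀ * c₀) (+ 2 * β * c₀) (β * β + + 4 * c₀) (+ 4 * β) (+ 4) (+ x)
      ≡⟨ ∑-quartic-closed n (c₀ * c₀) (+ 2 * β * c₀) (β * β + + 4 * c₀) (+ 4 * β) (+ 4) ⟩
    _                                                   ≡⟨ simplify N ⟩
    + 4 * (N * (N * N - + 1) * (+ 7 * N * N - + 8))     ∎)
    where
    N = + n
    β = - (+ 2 * (N - + 1))
    c₀ = N * N - N
    rescale : ∀ t → + 4 * (+ 60 * t) ≡ + 60 * (+ 4 * t)
    rescale = solve-∀
    simplify : ∀ N → let β = - (+ 2 * (N - + 1)); c₀ = N * N - N in
      + 60 * (c₀ * c₀) * N + + 30 * (+ 2 * β * c₀) * (N * (N - + 1))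
        + + 10 * (β * β + + 4 * c₀) * ((N - + 1) * N * (+ 2 * N - + 1))
        + + 15 * (+ 4 * β) * (N * N * (N - + 1) * (N - + 1))
        + + 2 * + 4 * ((N - + 1) * N * (+ 2 * N - + 1) * (+ 3 * N * N - + 3 * N - + 1))
      ≡ + 4 * (N * (N * N - + 1) * (+ 7 * N * N - + 8))
    simplify = solve-∀

module Arrangements where

  open import Defs using (allVecs; arrangements)
  open import Data.Nat as ℕ using (ℕ; zero; suc)
  import Data.Nat.Properties as ℕ
  open import Data.Fin as Fin using (Fin; punchOut)
  import Data.Fin.Properties as Fin
  open import Data.Fin.Permutation using (Permutation′; transpose; _⟨$⟩ʳ_; _⟨$⟩ˡ_; inverseˡ; inverseʳ; flip)
  open import Data.List using (List; []; _∷_; map; allFin; tabulate)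
  open import Data.Vec as Vec using (Vec; lookup; toList)
  import Data.Vec.Properties as Vec
  open import Data.List.Membership.Propositional using (_∈_)
  import Data.List.Membership.Propositional.Properties as ∈
  open import Data.List.Relation.Unary.Any using (here)
  open import Data.List.Relation.Unary.All as All using ([]; _∷_)
  import Data.List.Relation.Unary.All.Properties as All
  open import Data.List.Relation.Unary.AllPairs as AllPairs using ([]; _∷_)
  import Data.List.Relation.Unary.AllPairs.Properties as AllPairs
  open import Data.List.Relation.Unary.Unique.Propositional using (Unique)
  import Data.List.Relation.Unary.Unique.Propositional.Properties as Unique
  import Data.List.Relation.Unary.Unique.DecPropositional as UniqueDec
  open import Data.List.Relation.Binary.Disjoint.Propositional using (Disjoint)
  open import Data.List.Relation.Binary.Permutation.Propositional using (_↭_)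
  open import Data.List.Membership.Propositional.Properties.WithK using (unique∧set⇒bag)
  open import Data.List.Relation.Binary.BagAndSetEquality using (∼bag⇒↭)
  open import Data.Product using (∃; ∃₂; _×_; _,_; proj₂)
  open import Data.Empty using (⊥-elim)
  open import Function using (_∘_; Injective; mk⇔)
  open import Relation.Nullary using (¬_; yes; no)
  open import Relation.Nullary.Decidable using (dec-true; dec-false)
  open import Relation.Binary.PropositionalEquality

  private variable n : ℕ

  IsArrangement : Vec (Fin n) n → Set
  IsArrangement π = Injective _≡_ _≡_ (lookup π)

  unique⇒↭ : ∀ {A : Set} {xs ys : List A} → Unique xs → Unique ys →
             (∀ {x} → x ∈ xs → x ∈ ys) → (∀ {x} → x ∈ ys → x ∈ xs) → xs ↭ ys
  unique⇒↭ u v to from = ∼bag⇒↭ (unique∧set⇒bag u v (mk⇔ to from))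

  injective⇒surjective : (f : Fin n → Fin n) → Injective _≡_ _≡_ f → ∀ y → ∃ λ x → f x ≡ y
  injective⇒surjective {suc n} f inj y with Fin.any? (λ x → f x Fin.≟ y)
  ... | yes found = found
  ... | no  none  = ⊥-elim (collision (Fin.pigeonhole (ℕ.n<1+n n) g))
    where
    missed : ∀ x → y ≢ f x
    missed x eq = none (x , sym eq)
    g : Fin (suc n) → Fin n
    g x = punchOut (missed x)
    collision : ¬ ∃₂ λ i j → i Fin.< j × g i ≡ g j
    collision (i , j , i<j , gi≡gj) = Fin.<⇒≢ i<j (inj (Fin.punchOut-injective (missed i) (missed j) gi≡gj))

  injective-↭ : (f : Fin n → Fin n) → Injective _≡_ _≡_ f → map f (allFin n) ↭ allFin n
  injective-↭ {n} f inj = unique⇒↭ (Unique.map⁺ inj (Unique.allFin⁺ n)) (Unique.allFin⁺ n)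
    (λ {x} _ → ∈.∈-allFin x)
    (λ {y} _ → let x , fx≡y = injective⇒surjective f inj y in
               subst (_∈ map f (allFin n)) fx≡y (∈.∈-map⁺ f (∈.∈-allFin x)))

  allVecs-complete : ∀ n k (v : Vec (Fin n) k) → v ∈ allVecs n k
  allVecs-complete n zero    Vec.[]       = here refl
  allVecs-complete n (suc k) (x Vec.∷ v) =
    ∈.∈-concat⁺′ (∈.∈-map⁺ (x Vec.∷_) (allVecs-complete n k v))
                 (∈.∈-map⁺ (λ x → map (x Vec.∷_) (allVecs n k)) (∈.∈-allFin x))

  allVecs-unique : ∀ n k → Unique (allVecs n k)
  allVecs-unique n zero    = [] ∷ []
  allVecs-unique n (suc k) =
    Unique.concat⁺ (All.map⁺ (All.universal (λ _ → Unique.map⁺ Vec.∷-injectiveʳ (allVecs-unique n k)) _))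
                   (AllPairs.map⁺ (AllPairs.map disjoint (Unique.allFin⁺ n)))
    where
    disjoint : ∀ {x y : Fin n} → x ≢ y → Disjoint (map (x Vec.∷_) (allVecs n k)) (map (y Vec.∷_) (allVecs n k))
    disjoint x≢y (p , q) with _ , _ , refl ← ∈.∈-map⁻ _ p | _ , _ , eq ← ∈.∈-map⁻ _ q = x≢y (Vec.∷-injectiveˡ eq)

  tabulate-unique⇒injective : ∀ {A : Set} {k} {f : Fin k → A} → Unique (tabulate f) → Injective _≡_ _≡_ f
  tabulate-unique⇒injective (_  ∷ u) {Fin.zero}  {Fin.zero}  eq = refl
  tabulate-unique⇒injective (fx ∷ u) {Fin.zero}  {Fin.suc j} eq = ⊥-elim (All.tabulate⁻ fx j eq)
  tabulate-unique⇒injective (fx ∷ u) {Fin.suc i} {Fin.zero}  eq = ⊥-elim (All.tabulate⁻ fx i (sym eq))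
  tabulate-unique⇒injective (_  ∷ u) {Fin.suc i} {Fin.suc j} eq = cong Fin.suc (tabulate-unique⇒injective u eq)

  toList≡tabulate : ∀ {A : Set} {k} (v : Vec A k) → toList v ≡ tabulate (lookup v)
  toList≡tabulate Vec.[]       = refl
  toList≡tabulate (x Vec.∷ v) = cong (x ∷_) (toList≡tabulate v)

  private
    unique? = λ n (v : Vec (Fin n) n) → UniqueDec.unique? (Fin._≟_ {n}) (toList v)

  ∈-arrangements⁻ : ∀ {π : Vec (Fin n) n} → π ∈ arrangements n → IsArrangement π
  ∈-arrangements⁻ {n} {π} π∈ = tabulate-unique⇒injective
    (subst Unique (toList≡tabulate π) (∈.∈-filter⁻ (unique? n) {xs = allVecs n n} π∈ .proj₂))

  ∈-arrangements⁺ : ∀ {π : Vec (Fin n) n} → IsArrangement π → π ∈ arrangements n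
  ∈-arrangements⁺ {n} {π} inj = ∈.∈-filter⁺ (unique? n) (allVecs-complete n n π)
    (subst Unique (sym (toList≡tabulate π)) (Unique.tabulate⁺ inj))

  arrangements-unique : ∀ n → Unique (arrangements n)
  arrangements-unique n = Unique.filter⁺ (unique? n) (allVecs-unique n n)

  _⊙_ : Vec (Fin n) n → Permutation′ n → Vec (Fin n) n
  π ⊙ σ = Vec.tabulate (λ i → lookup π (σ ⟨$⟩ʳ i))

  lookup-⊙ : ∀ (π : Vec (Fin n) n) σ i → lookup (π ⊙ σ) i ≡ lookup π (σ ⟨$⟩ʳ i)
  lookup-⊙ π σ = Vec.lookup∘tabulate _

  ⊙-flip : ∀ (π : Vec (Fin n) n) σ → (π ⊙ σ) ⊙ flip σ ≡ π
  ⊙-flip π σ = trans (Vec.tabulate-cong (λ i → trans (lookup-⊙ π σ (σ ⟨$⟩ˡ i)) (cong (lookup π) (inverseʳ σ))))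
                     (Vec.tabulate∘lookup π)

  ⊙-injective : ∀ (σ : Permutation′ n) → Injective _≡_ _≡_ (_⊙ σ)
  ⊙-injective σ {π} {ρ} eq = trans (sym (⊙-flip π σ)) (trans (cong (_⊙ flip σ) eq) (⊙-flip ρ σ))

  ⊙-isArrangement : ∀ (π : Vec (Fin n) n) σ → IsArrangement π → IsArrangement (π ⊙ σ)
  ⊙-isArrangement π σ inj {i} {j} eq =
    trans (sym (inverseˡ σ)) (trans (cong (σ ⟨$⟩ˡ_) σi≡σj) (inverseˡ σ))
    where σi≡σj = inj (trans (sym (lookup-⊙ π σ i)) (trans eq (lookup-⊙ π σ j)))

  ⊙-↭ : ∀ (σ : Permutation′ n) → map (_⊙ σ) (arrangements n) ↭ arrangements n
  ⊙-↭ {n} σ = unique⇒↭ (Unique.map⁺ (⊙-injective σ) (arrangements-unique n)) (arrangements-unique n)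
    (λ π⊙σ∈ → let π , π∈ , eq = ∈.∈-map⁻ (_⊙ σ) π⊙σ∈ in
              subst (_∈ arrangements n) (sym eq) (∈-arrangements⁺ (⊙-isArrangement π σ (∈-arrangements⁻ π∈))))
    (λ {π} π∈ → subst (_∈ map (_⊙ σ) (arrangements n)) (⊙-flip π (flip σ))
                 (∈.∈-map⁺ (_⊙ σ) {x = π ⊙ flip σ} (∈-arrangements⁺ (⊙-isArrangement π (flip σ) (∈-arrangements⁻ π∈)))))

  transpose-matchˡ : ∀ (i j : Fin n) → transpose i j ⟨$⟩ʳ i ≡ j
  transpose-matchˡ i j rewrite dec-true (i Fin.≟ i) refl = refl

  transpose-fix : ∀ {i j k : Fin n} → k ≢ i → k ≢ j → transpose i j ⟨$⟩ʳ k ≡ k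
  transpose-fix {i = i} {j} {k} k≢i k≢j rewrite dec-false (k Fin.≟ i) k≢i | dec-false (k Fin.≟ j) k≢j = refl

  identity-isArrangement : ∀ n → IsArrangement (Vec.tabulate {n = n} (λ i → i))
  identity-isArrangement n {i} {j} eq = trans (sym (Vec.lookup∘tabulate (λ x → x) i)) (trans eq (Vec.lookup∘tabulate (λ x → x) j))

module Exchangeability where

  open import Defs using (Σ[_]; arrangements)
  open ListSums
  open FinSums
  open Arrangements
  open import Data.Nat as ℕ using (ℕ; suc; _+_; _*_)
  import Data.Nat.Properties as ℕ
  open import Data.Fin using (Fin; toℕ)
  open import Data.Fin.Permutation using (Permutation′; transpose)
  open import Data.List using ([]; _∷_; allFin; length)
  open import Data.Vec using (Vec; lookup; tabulate)
  open import Data.List.Membership.Propositional using (_∈_; _∉_)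
  open import Data.List.Relation.Unary.Any using (here; there)
  open import Data.List.Relation.Unary.All using ([]; _∷_)
  open import Data.List.Relation.Unary.AllPairs using ([]; _∷_)
  open import Function using (_∘_)
  open import Data.Product using (∃; _×_; _,_)
  open import Relation.Binary.PropositionalEquality
  open ≡-Reasoning

  private variable n : ℕ

  pos : Vec (Fin n) n → Fin n → ℕ
  pos π i = toℕ (lookup π i)

  #arrangements : ℕ → ℕ
  #arrangements n = length (arrangements n)

  arrangements-nonempty : ∀ n → ∃ λ l → #arrangements n ≡ suc l
  arrangements-nonempty n with arrangements n | ∈-arrangements⁺ {π = tabulate (λ i → i)} (identity-isArrangement n)
  ... | []     | ()
  ... | _ ∷ πs | _ = length πs , refl

  -- The sum over all arrangements, i.e. #arrangements n times the expectation in the paper.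
  𝔼 : (Vec (Fin n) n → ℕ) → ℕ
  𝔼 {n} F = ∑ (arrangements n) F

  𝔼-cong : ∀ {F G : Vec (Fin n) n → ℕ} → (∀ {π} → π ∈ arrangements n → F π ≡ G π) → 𝔼 F ≡ 𝔼 G
  𝔼-cong {n} = ∑-cong-∈ (arrangements n)

  𝔼-zero : ∀ {F : Vec (Fin n) n → ℕ} → (∀ π → F π ≡ 0) → 𝔼 F ≡ 0
  𝔼-zero {n} F≡0 = trans (𝔼-cong (λ {π} _ → F≡0 π)) (∑-zero (arrangements n))

  𝔼-const : ∀ n c → 𝔼 {n} (λ _ → c) ≡ #arrangements n * c
  𝔼-const n = ∑-const (arrangements n)

  𝔼-⊙ : ∀ (σ : Permutation′ n) (F : Vec (Fin n) n → ℕ) → 𝔼 (λ π → F (π ⊙ σ)) ≡ 𝔼 F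
  𝔼-⊙ {n} σ F = trans (sym (∑-map (arrangements n) (_⊙ σ) F)) (∑-↭ F (⊙-↭ σ))

  Σ-pos : ∀ {π : Vec (Fin n) n} → π ∈ arrangements n → (g : ℕ → ℕ) → Σ[ n ] (λ y → g (pos π y)) ≡ Σ[ n ] (g ∘ toℕ)
  Σ-pos {n} {π} π∈ g = trans (sym (∑-map (allFin n) (lookup π) (g ∘ toℕ)))
                             (∑-↭ (g ∘ toℕ) (injective-↭ (lookup π) (∈-arrangements⁻ π∈)))

  Σ-𝔼 : ∀ (G : Vec (Fin n) n → ℕ → ℕ) → Σ[ n ] (λ y → 𝔼 (λ π → G π (pos π y))) ≡ 𝔼 (λ π → Σ[ n ] (G π ∘ toℕ))
  Σ-𝔼 {n} G = trans (∑-comm (allFin n) (arrangements n) _)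
    (𝔼-cong {F = λ π → Σ[ n ] (λ y → G π (pos π y))} (λ {π} π∈ → Σ-pos π∈ (G π)))

  𝔼-Σ : ∀ {n} (F : Vec (Fin n) n → Fin n → ℕ) → 𝔼 (λ π → Σ[ n ] (F π)) ≡ Σ[ n ] (λ y → 𝔼 (λ π → F π y))
  𝔼-Σ {n} F = ∑-comm (arrangements n) (allFin n) F

  𝔼-Σ⁴ : ∀ {n} (F : Vec (Fin n) n → Fin n → Fin n → Fin n → Fin n → ℕ) →
         𝔼 (λ π → Σ⁴ n (F π)) ≡ Σ⁴ n (λ i j k l → 𝔼 (λ π → F π i j k l))
  𝔼-Σ⁴ {n} F = trans (𝔼-Σ (λ π i → Σ³ (F π i))) (∑-cong (allFin n) (λ i →
               trans (𝔼-Σ (λ π j → Σ² n (F π i j))) (∑-cong (allFin n) (λ j →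
               trans (𝔼-Σ (λ π k → Σ[ n ] (F π i j k))) (∑-cong (allFin n) (λ k → 𝔼-Σ (λ π → F π i j k)))))))
    where Σ³ : (Fin n → Fin n → Fin n → ℕ) → ℕ
          Σ³ H = Σ[ n ] (λ j → Σ² n (H j))

  module _ (π : Vec (Fin n) n) (k x : Fin n) where

    pos-⊙-match : pos (π ⊙ transpose k x) k ≡ pos π x
    pos-⊙-match = cong toℕ (trans (lookup-⊙ π (transpose k x) k) (cong (lookup π) (transpose-matchˡ k x)))

    pos-⊙-fix : ∀ {i} → i ≢ k → i ≢ x → pos (π ⊙ transpose k x) i ≡ pos π i
    pos-⊙-fix {i} i≢k i≢x = cong toℕ (trans (lookup-⊙ π (transpose k x) i) (cong (lookup π) (transpose-fix i≢k i≢x)))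

  𝔼₁ : (ℕ → ℕ) → Fin n → ℕ
  𝔼₁ Φ i = 𝔼 λ π → Φ (pos π i)

  𝔼₂ : (ℕ → ℕ → ℕ) → Fin n → Fin n → ℕ
  𝔼₂ Φ i j = 𝔼 λ π → Φ (pos π i) (pos π j)

  𝔼₃ : (ℕ → ℕ → ℕ → ℕ) → Fin n → Fin n → Fin n → ℕ
  𝔼₃ Φ i j k = 𝔼 λ π → Φ (pos π i) (pos π j) (pos π k)

  𝔼₄ : (ℕ → ℕ → ℕ → ℕ → ℕ) → Fin n → Fin n → Fin n → Fin n → ℕ
  𝔼₄ Φ i j k l = 𝔼 λ π → Φ (pos π i) (pos π j) (pos π k) (pos π l)

  𝔼-transpose : ∀ (k x : Fin n) (F G : Vec (Fin n) n → ℕ) → (∀ π → F (π ⊙ transpose k x) ≡ G π) → 𝔼 G ≡ 𝔼 F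
  𝔼-transpose {n} k x F G eq = trans (sym (∑-cong (arrangements n) eq)) (𝔼-⊙ (transpose k x) F)

  private
    ∉₁ : ∀ {x i : Fin n} → x ∉ i ∷ [] → i ≢ x
    ∉₁ x∉ i≡x = x∉ (here (sym i≡x))

    ∉₂ : ∀ {x i j : Fin n} → x ∉ i ∷ j ∷ [] → i ≢ x × j ≢ x
    ∉₂ x∉ = (λ i≡x → x∉ (here (sym i≡x))) , (λ j≡x → x∉ (there (here (sym j≡x))))

    ∉₃ : ∀ {x i j k : Fin n} → x ∉ i ∷ j ∷ k ∷ [] → i ≢ x × j ≢ x × k ≢ x
    ∉₃ x∉ = (λ i≡x → x∉ (here (sym i≡x))) , (λ j≡x → x∉ (there (here (sym j≡x))))
          , (λ k≡x → x∉ (there (there (here (sym k≡x)))))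

  𝔼₁-total : ∀ Φ (i : Fin n) → n * 𝔼₁ Φ i ≡ #arrangements n * Σ[ n ] (Φ ∘ toℕ)
  𝔼₁-total {n} Φ i = begin
    n * 𝔼₁ Φ i                        ≡⟨ ℕ.+-identityʳ _ ⟨
    n * 𝔼₁ Φ i + 0                    ≡⟨ Σ-constant-outside n [] [] (𝔼₁ Φ) i (λ x _ → exchange x) ⟨
    Σ[ n ] (𝔼₁ Φ) + 0                 ≡⟨ ℕ.+-identityʳ _ ⟩
    Σ[ n ] (𝔼₁ Φ)                     ≡⟨ Σ-𝔼 {n} (λ _ → Φ) ⟩
    𝔼 {n} (λ _ → Σ[ n ] (Φ ∘ toℕ))    ≡⟨ 𝔼-const n _ ⟩
    #arrangements n * Σ[ n ] (Φ ∘ toℕ) ∎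
    where
    exchange : ∀ x → 𝔼₁ Φ x ≡ 𝔼₁ Φ i
    exchange x = 𝔼-transpose i x _ _ (λ π → cong Φ (pos-⊙-match π i x))

  -- Any vertex other than the fixed ones can be exchanged for the last one, so summing over the last
  -- vertex gives n − #fixed copies of the generic term plus the terms where it meets a fixed vertex.
  Σ-𝔼₂-last : ∀ Φ {i j : Fin n} → i ≢ j → Σ[ n ] (𝔼₂ Φ i) + 𝔼₂ Φ i j ≡ n * 𝔼₂ Φ i j + 𝔼₂ Φ i i
  Σ-𝔼₂-last {n} Φ {i} {j} i≢j = begin
    Σ[ n ] (𝔼₂ Φ i) + 𝔼₂ Φ i j         ≡⟨ cong (Σ[ n ] (𝔼₂ Φ i) +_) (ℕ.*-identityˡ _) ⟨
    Σ[ n ] (𝔼₂ Φ i) + 1 * 𝔼₂ Φ i j     ≡⟨ Σ-constant-outside n (i ∷ []) ([] ∷ []) (𝔼₂ Φ i) j (λ x x∉ → exchange x (∉₁ x∉)) ⟩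
    n * 𝔼₂ Φ i j + (𝔼₂ Φ i i + 0)      ≡⟨ cong (n * 𝔼₂ Φ i j +_) (ℕ.+-identityʳ _) ⟩
    n * 𝔼₂ Φ i j + 𝔼₂ Φ i i            ∎
    where
    exchange : ∀ x → i ≢ x → 𝔼₂ Φ i x ≡ 𝔼₂ Φ i j
    exchange x i≢x = 𝔼-transpose j x _ _ (λ π → cong₂ Φ (pos-⊙-fix π j x i≢j i≢x) (pos-⊙-match π j x))

  Σ-𝔼₃-last : ∀ Φ {i j k : Fin n} → i ≢ j → i ≢ k → j ≢ k →
            Σ[ n ] (𝔼₃ Φ i j) + 2 * 𝔼₃ Φ i j k ≡ n * 𝔼₃ Φ i j k + (𝔼₃ Φ i j i + 𝔼₃ Φ i j j)
  Σ-𝔼₃-last {n} Φ {i} {j} {k} i≢j i≢k j≢k = trans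
    (Σ-constant-outside n (i ∷ j ∷ []) ((i≢j ∷ []) ∷ [] ∷ []) (𝔼₃ Φ i j) k (λ x x∉ → exchange x (∉₂ x∉)))
    (cong (λ d → n * 𝔼₃ Φ i j k + (𝔼₃ Φ i j i + d)) (ℕ.+-identityʳ _))
    where
    exchange : ∀ x → i ≢ x × j ≢ x → 𝔼₃ Φ i j x ≡ 𝔼₃ Φ i j k
    exchange x (i≢x , j≢x) = 𝔼-transpose k x _ _ (λ π →
      trans (cong₂ (λ a b → Φ a b _) (pos-⊙-fix π k x i≢k i≢x) (pos-⊙-fix π k x j≢k j≢x)) (cong (Φ _ _) (pos-⊙-match π k x)))

  Σ-𝔼₄-last : ∀ Φ {i j k l : Fin n} → i ≢ j → i ≢ k → j ≢ k → i ≢ l → j ≢ l → k ≢ l →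
            Σ[ n ] (𝔼₄ Φ i j k) + 3 * 𝔼₄ Φ i j k l ≡ n * 𝔼₄ Φ i j k l + (𝔼₄ Φ i j k i + (𝔼₄ Φ i j k j + 𝔼₄ Φ i j k k))
  Σ-𝔼₄-last {n} Φ {i} {j} {k} {l} i≢j i≢k j≢k i≢l j≢l k≢l = trans
    (Σ-constant-outside n (i ∷ j ∷ k ∷ []) ((i≢j ∷ i≢k ∷ []) ∷ (j≢k ∷ []) ∷ [] ∷ []) (𝔼₄ Φ i j k) l
                    (λ x x∉ → exchange x (∉₃ x∉)))
    (cong (λ d → n * 𝔼₄ Φ i j k l + (𝔼₄ Φ i j k i + (𝔼₄ Φ i j k j + d))) (ℕ.+-identityʳ _))
    where
    exchange : ∀ x → i ≢ x × j ≢ x × k ≢ x → 𝔼₄ Φ i j k x ≡ 𝔼₄ Φ i j k l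
    exchange x (i≢x , j≢x , k≢x) = 𝔼-transpose l x _ _ (λ π →
      trans (cong₂ (λ a b → Φ a b _ _) (pos-⊙-fix π l x i≢l i≢x) (pos-⊙-fix π l x j≢l j≢x))
            (cong₂ (Φ _ _) (pos-⊙-fix π l x k≢l k≢x) (pos-⊙-match π l x)))

  𝔼₂-offDiagonal : ∀ Φ → (∀ x → Φ x x ≡ 0) → ∀ {i j : Fin n} → i ≢ j →
    n * (n * 𝔼₂ Φ i j) ≡ n * 𝔼₂ Φ i j + #arrangements n * Σ[ n ] (λ x → Σ[ n ] (Φ (toℕ x) ∘ toℕ))
  𝔼₂-offDiagonal {n} Φ Φ-diag {i} {j} i≢j = begin
    n * (n * P)                          ≡⟨ cong (n *_) last ⟨
    n * (Σ[ n ] (𝔼₂ Φ i) + P)            ≡⟨ ℕ.*-distribˡ-+ n _ P ⟩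
    n * Σ[ n ] (𝔼₂ Φ i) + n * P          ≡⟨ cong (λ s → n * s + n * P) (Σ-𝔼 {n} (λ π → Φ (pos π i))) ⟩
    n * 𝔼₁ (λ x → Σ[ n ] (Φ x ∘ toℕ)) i + n * P ≡⟨ cong (_+ n * P) (𝔼₁-total (λ x → Σ[ n ] (Φ x ∘ toℕ)) i) ⟩
    #arrangements n * Σ[ n ] (λ x → Σ[ n ] (Φ (toℕ x) ∘ toℕ)) + n * P ≡⟨ ℕ.+-comm _ (n * P) ⟩
    n * P + #arrangements n * Σ[ n ] (λ x → Σ[ n ] (Φ (toℕ x) ∘ toℕ)) ∎
    where
    P = 𝔼₂ Φ i j
    last : Σ[ n ] (𝔼₂ Φ i) + P ≡ n * P
    last = trans (Σ-𝔼₂-last Φ i≢j) (trans (cong (n * P +_) (𝔼-zero (λ π → Φ-diag (pos π i)))) (ℕ.+-identityʳ _))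

module DistanceMoments where

  open import Defs using (Σ[_]; arrangements)
  open ListSums
  open FinSums
  open DistanceSums
  open Exchangeability
  open import Data.Nat as ℕ using (ℕ; ∣_-_∣)
  import Data.Nat.Properties as ℕ
  open import Data.Integer as ℤ using (ℤ; +_; -_; _+_; _*_; _-_; NonZero)
  import Data.Integer.Properties as ℤ
  open import Data.Integer.Tactic.RingSolver using (solve-∀)
  open import Data.Fin using (Fin; toℕ)
  open import Data.List using ([]; _∷_; allFin)
  open import Data.List.Relation.Unary.All using ([]; _∷_)
  open import Data.List.Relation.Unary.AllPairs using ([]; _∷_)
  open import Function using (_∘_)
  open import Relation.Binary.PropositionalEquality
  open ≡-Reasoning

  private variable a c t d : ℕ

  pos-last : ∀ n → a ℕ.+ c ℕ.* t ≡ n ℕ.* t ℕ.+ d → + a + + c * + t ≡ + n * + t + + d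
  pos-last {a} {c} {t} {d} n eq = begin
    + a + + c * + t        ≡⟨ cong (λ s → + a + s) (ℤ.pos-* c t) ⟨
    + a + + (c ℕ.* t)      ≡⟨ ℤ.pos-+ a (c ℕ.* t) ⟨
    + (a ℕ.+ c ℕ.* t)      ≡⟨ cong +_ eq ⟩
    + (n ℕ.* t ℕ.+ d)      ≡⟨ ℤ.pos-+ (n ℕ.* t) d ⟩
    + (n ℕ.* t) + + d      ≡⟨ cong (_+ + d) (ℤ.pos-* n t) ⟩
    + n * + t + + d        ∎

  nonZero-N-k : ∀ {n k} → k ℕ.< n → NonZero (+ n - + k)
  nonZero-N-k k<n = ℤ.≢-nonZero (λ eq → ℕ.<⇒≢ k<n (sym (ℤ.+-injective (ℤ.i-j≡0⇒i≡j _ _ eq))))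

  pair-value : ∀ N L {u a} k w .{{_ : NonZero (N * (N - + 1))}} →
               N * (N * u) ≡ N * u + L * a → k * a ≡ N * (N - + 1) * w → k * u ≡ L * w
  pair-value N L {u} {a} k w recurrence closed = ℤ.*-cancelˡ-≡ (N * (N - + 1)) (k * u) (L * w) (begin
    N * (N - + 1) * (k * u)        ≡⟨ expand N k u ⟩
    k * (N * (N * u) - N * u)      ≡⟨ cong (λ s → k * (s - N * u)) recurrence ⟩
    k * (N * u + L * a - N * u)    ≡⟨ collect N k u L a ⟩
    L * (k * a)                    ≡⟨ cong (L *_) closed ⟩
    L * (N * (N - + 1) * w)        ≡⟨ reorder N L w ⟩
    N * (N - + 1) * (L * w)        ∎)
    where
    expand : ∀ N k u → N * (N - + 1) * (k * u) ≡ k * (N * (N * u) - N * u)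
    expand = solve-∀
    collect : ∀ N k u L a → k * (N * u + L * a - N * u) ≡ L * (k * a)
    collect = solve-∀
    reorder : ∀ N L w → L * (N * (N - + 1) * w) ≡ N * (N - + 1) * (L * w)
    reorder = solve-∀

  dist : ℕ → ℕ → ℕ
  dist x y = ∣ x - y ∣

  dist² : ℕ → ℕ → ℕ
  dist² x y = dist x y ℕ.* dist x y

  dist²-self : ∀ x → dist² x x ≡ 0
  dist²-self x = cong (λ d → d ℕ.* d) (ℕ.∣n-n∣≡0 x)

  distStar : ℕ → ℕ → ℕ → ℕ
  distStar x y z = dist x y ℕ.* dist x z

  distPair : ℕ → ℕ → ℕ → ℕ → ℕ
  distPair x y z w = dist x y ℕ.* dist z w

  module _ (n : ℕ) where
    private
      N = + n
      L = + #arrangements n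

    2≤n : ∀ {i j : Fin n} → i ≢ j → 2 ℕ.≤ n
    2≤n i≢j = unique-length≤ n (_ ∷ _ ∷ []) ((i≢j ∷ []) ∷ [] ∷ [])

    nonZero-N[N-1] : 2 ℕ.≤ n → NonZero (N * (N - + 1))
    nonZero-N[N-1] 2≤n = ℤ.i*j≢0 N (N - + 1) {{N≢0}} {{nonZero-N-k 2≤n}}
      where N≢0 = subst NonZero (ℤ.+-identityʳ N) (nonZero-N-k (ℕ.<-≤-trans (ℕ.s≤s ℕ.z≤n) 2≤n))

    𝔼₂-offDiagonal-ℤ : ∀ Φ → (∀ x → Φ x x ≡ 0) → ∀ {i j : Fin n} → i ≢ j →
      N * (N * + 𝔼₂ Φ i j) ≡ N * + 𝔼₂ Φ i j + L * + Σ[ n ] (λ x → Σ[ n ] (Φ (toℕ x) ∘ toℕ))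
    𝔼₂-offDiagonal-ℤ Φ Φ-diag {i} {j} i≢j = begin
      N * (N * + P)        ≡⟨ cong (N *_) (ℤ.pos-* n P) ⟨
      N * + (n ℕ.* P)      ≡⟨ ℤ.pos-* n (n ℕ.* P) ⟨
      + (n ℕ.* (n ℕ.* P))  ≡⟨ cong +_ (𝔼₂-offDiagonal Φ Φ-diag i≢j) ⟩
      + (n ℕ.* P ℕ.+ #arrangements n ℕ.* S) ≡⟨ ℤ.pos-+ (n ℕ.* P) (#arrangements n ℕ.* S) ⟩
      + (n ℕ.* P) + + (#arrangements n ℕ.* S) ≡⟨ cong₂ _+_ (ℤ.pos-* n P) (ℤ.pos-* (#arrangements n) S) ⟩
      N * + P + L * + S    ∎
      where
      P = 𝔼₂ Φ i j
      S = Σ[ n ] (λ x → Σ[ n ] (Φ (toℕ x) ∘ toℕ))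

    𝔼-dist : ∀ {i j : Fin n} → i ≢ j → + 3 * + 𝔼₂ dist i j ≡ L * (N + + 1)
    𝔼-dist i≢j = pair-value N L (+ 3) (N + + 1) {{nonZero-N[N-1] (2≤n i≢j)}}
      (𝔼₂-offDiagonal-ℤ dist ℕ.∣n-n∣≡0 i≢j) (trans (totalDist-closed n) (reshape N))
      where reshape : ∀ N → (N - + 1) * N * (N + + 1) ≡ N * (N - + 1) * (N + + 1)
            reshape = solve-∀

    𝔼-dist² : ∀ {i j : Fin n} → i ≢ j → + 6 * + 𝔼₂ dist² i j ≡ L * (N * (N + + 1))
    𝔼-dist² i≢j = pair-value N L (+ 6) (N * (N + + 1)) {{nonZero-N[N-1] (2≤n i≢j)}}
      (𝔼₂-offDiagonal-ℤ dist² dist²-self i≢j) (trans (totalDistSq-closed n) (reshape N))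
      where reshape : ∀ N → N * N * (N - + 1) * (N + + 1) ≡ N * (N - + 1) * (N * (N + + 1))
            reshape = solve-∀

    distTimesDistSum : ℕ → ℕ → ℕ
    distTimesDistSum x y = dist x y ℕ.* distSum n x

    𝔼-distTimesDistSum : ∀ {i j : Fin n} → i ≢ j →
      + 60 * + 𝔼₂ distTimesDistSum i j ≡ L * ((N + + 1) * (+ 7 * N * N - + 8))
    𝔼-distTimesDistSum i≢j = pair-value N L (+ 60) ((N + + 1) * (+ 7 * N * N - + 8)) {{nonZero-N[N-1] (2≤n i≢j)}}
      (𝔼₂-offDiagonal-ℤ distTimesDistSum (λ x → cong (ℕ._* distSum n x) (ℕ.∣n-n∣≡0 x)) i≢j)
      (begin
        + 60 * + Σ[ n ] (λ x → Σ[ n ] (distTimesDistSum (toℕ x) ∘ toℕ)) ≡⟨ cong (λ s → + 60 * + s) factor ⟩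
        + 60 * + totalDistSumSq n                                       ≡⟨ totalDistSumSq-closed n ⟩
        N * (N * N - + 1) * (+ 7 * N * N - + 8)                         ≡⟨ reshape N ⟩
        N * (N - + 1) * ((N + + 1) * (+ 7 * N * N - + 8))               ∎)
      where
      factor : Σ[ n ] (λ x → Σ[ n ] (distTimesDistSum (toℕ x) ∘ toℕ)) ≡ totalDistSumSq n
      factor = ∑-cong (allFin n) (λ x → ∑-*ʳ (allFin n) (distSum n (toℕ x)) (λ y → dist (toℕ x) (toℕ y)))
      reshape : ∀ N → N * (N * N - + 1) * (+ 7 * N * N - + 8) ≡ N * (N - + 1) * ((N + + 1) * (+ 7 * N * N - + 8))
      reshape = solve-∀

    3≤n : ∀ {i j k : Fin n} → i ≢ j → i ≢ k → j ≢ k → 3 ℕ.≤ n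
    3≤n i≢j i≢k j≢k = unique-length≤ n (_ ∷ _ ∷ _ ∷ []) ((i≢j ∷ i≢k ∷ []) ∷ (j≢k ∷ []) ∷ [] ∷ [])

    4≤n : ∀ {i j k l : Fin n} → i ≢ j → i ≢ k → j ≢ k → i ≢ l → j ≢ l → k ≢ l → 4 ℕ.≤ n
    4≤n i≢j i≢k j≢k i≢l j≢l k≢l = unique-length≤ n (_ ∷ _ ∷ _ ∷ _ ∷ [])
      ((i≢j ∷ i≢k ∷ i≢l ∷ []) ∷ (j≢k ∷ j≢l ∷ []) ∷ (k≢l ∷ []) ∷ [] ∷ [])

    Σ-𝔼₃-last-ℤ : ∀ Φ {i j k : Fin n} → i ≢ j → i ≢ k → j ≢ k →
      + Σ[ n ] (𝔼₃ Φ i j) + + 2 * + 𝔼₃ Φ i j k ≡ N * + 𝔼₃ Φ i j k + (+ 𝔼₃ Φ i j i + + 𝔼₃ Φ i j j)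
    Σ-𝔼₃-last-ℤ Φ {i} {j} {k} i≢j i≢k j≢k =
      trans (pos-last {Σ[ n ] (𝔼₃ Φ i j)} {2} {𝔼₃ Φ i j k} {𝔼₃ Φ i j i ℕ.+ 𝔼₃ Φ i j j} n (Σ-𝔼₃-last Φ i≢j i≢k j≢k))
            (cong (λ s → N * + 𝔼₃ Φ i j k + s) (ℤ.pos-+ (𝔼₃ Φ i j i) (𝔼₃ Φ i j j)))

    Σ-𝔼₄-last-ℤ : ∀ Φ {i j k l : Fin n} → i ≢ j → i ≢ k → j ≢ k → i ≢ l → j ≢ l → k ≢ l →
      + Σ[ n ] (𝔼₄ Φ i j k) + + 3 * + 𝔼₄ Φ i j k l ≡ N * + 𝔼₄ Φ i j k l + (+ 𝔼₄ Φ i j k i + (+ 𝔼₄ Φ i j k j + + 𝔼₄ Φ i j k k))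
    Σ-𝔼₄-last-ℤ Φ {i} {j} {k} {l} i≢j i≢k j≢k i≢l j≢l k≢l =
      trans (pos-last {Σ[ n ] (𝔼₄ Φ i j k)} {3} {𝔼₄ Φ i j k l} {𝔼₄ Φ i j k i ℕ.+ (𝔼₄ Φ i j k j ℕ.+ 𝔼₄ Φ i j k k)} n
                      (Σ-𝔼₄-last Φ i≢j i≢k j≢k i≢l j≢l k≢l))
            (cong (λ s → N * + 𝔼₄ Φ i j k l + s)
                  (trans (ℤ.pos-+ (𝔼₄ Φ i j k i) _) (cong (λ s → + 𝔼₄ Φ i j k i + s) (ℤ.pos-+ (𝔼₄ Φ i j k j) (𝔼₄ Φ i j k k)))))

    Σ-last-distStar : ∀ {i j k : Fin n} → i ≢ j → i ≢ k → j ≢ k →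
      + 𝔼₂ distTimesDistSum i j + + 2 * + 𝔼₃ distStar i j k ≡ N * + 𝔼₃ distStar i j k + + 𝔼₂ dist² i j
    Σ-last-distStar {i} {j} {k} i≢j i≢k j≢k = begin
      + 𝔼₂ distTimesDistSum i j + + 2 * q                  ≡⟨ cong (λ s → + s + + 2 * q) factor ⟨
      + Σ[ n ] (𝔼₃ distStar i j) + + 2 * q                 ≡⟨ Σ-𝔼₃-last-ℤ distStar i≢j i≢k j≢k ⟩
      N * q + (+ 𝔼₃ distStar i j i + + 𝔼₂ dist² i j)       ≡⟨ cong (λ d → N * q + (+ d + + 𝔼₂ dist² i j)) degenerate ⟩
      N * q + (+ 0 + + 𝔼₂ dist² i j)                       ≡⟨ cong (λ d → N * q + d) (ℤ.+-identityˡ _) ⟩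
      N * q + + 𝔼₂ dist² i j                               ∎
      where
      q = + 𝔼₃ distStar i j k
      factor : Σ[ n ] (𝔼₃ distStar i j) ≡ 𝔼₂ distTimesDistSum i j
      factor = trans (Σ-𝔼 {n} (λ π → distStar (pos π i) (pos π j)))
        (𝔼-cong (λ {π} _ → ∑-*ˡ (allFin n) (dist (pos π i) (pos π j)) (λ z → dist (pos π i) (toℕ z))))
      degenerate : 𝔼₃ distStar i j i ≡ 0
      degenerate = 𝔼-zero (λ π → trans (cong (dist (pos π i) (pos π j) ℕ.*_) (ℕ.∣n-n∣≡0 (pos π i)))
                                        (ℕ.*-zeroʳ (dist (pos π i) (pos π j))))

    𝔼-distStar : ∀ {i j k : Fin n} → i ≢ j → i ≢ k → j ≢ k →
      + 60 * + 𝔼₃ distStar i j k ≡ L * ((N + + 1) * (+ 7 * N + + 4))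
    𝔼-distStar {i} {j} {k} i≢j i≢k j≢k = ℤ.*-cancelˡ-≡ (N - + 2) _ _ {{nonZero-N-k (3≤n i≢j i≢k j≢k)}} (begin
      (N - + 2) * (+ 60 * q)                              ≡⟨ expand N q Q₂ ⟩
      + 60 * (N * q + Q₂) - + 120 * q - + 10 * (+ 6 * Q₂) ≡⟨ cong (λ s → + 60 * s - + 120 * q - + 10 * (+ 6 * Q₂)) (Σ-last-distStar i≢j i≢k j≢k) ⟨
      + 60 * (P + + 2 * q) - + 120 * q - + 10 * (+ 6 * Q₂) ≡⟨ collect P q (+ 6 * Q₂) ⟩
      + 60 * P - + 10 * (+ 6 * Q₂)                        ≡⟨ cong₂ (λ a b → a - + 10 * b) (𝔼-distTimesDistSum i≢j) (𝔼-dist² i≢j) ⟩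
      L * ((N + + 1) * (+ 7 * N * N - + 8)) - + 10 * (L * (N * (N + + 1))) ≡⟨ factor N L ⟩
      (N - + 2) * (L * ((N + + 1) * (+ 7 * N + + 4)))    ∎)
      where
      q = + 𝔼₃ distStar i j k
      P = + 𝔼₂ distTimesDistSum i j
      Q₂ = + 𝔼₂ dist² i j
      expand : ∀ N q Q₂ → (N - + 2) * (+ 60 * q) ≡ + 60 * (N * q + Q₂) - + 120 * q - + 10 * (+ 6 * Q₂)
      expand = solve-∀
      collect : ∀ P q S → + 60 * (P + + 2 * q) - + 120 * q - + 10 * S ≡ + 60 * P - + 10 * S
      collect = solve-∀
      factor : ∀ N L → L * ((N + + 1) * (+ 7 * N * N - + 8)) - + 10 * (L * (N * (N + + 1)))
                       ≡ (N - + 2) * (L * ((N + + 1) * (+ 7 * N + + 4)))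
      factor = solve-∀

    distTimesDistSum₃ : ℕ → ℕ → ℕ → ℕ
    distTimesDistSum₃ x y z = dist x y ℕ.* distSum n z

    Σ-last-distTimesDistSum₃ : ∀ {i j k : Fin n} → i ≢ j → i ≢ k → j ≢ k →
      + 𝔼₂ dist i j * + totalDist n + + 2 * + 𝔼₃ distTimesDistSum₃ i j k
      ≡ N * + 𝔼₃ distTimesDistSum₃ i j k + (+ 𝔼₂ distTimesDistSum i j + + 𝔼₂ distTimesDistSum j i)
    Σ-last-distTimesDistSum₃ {i} {j} {k} i≢j i≢k j≢k = begin
      + 𝔼₂ dist i j * + totalDist n + + 2 * r              ≡⟨ cong (_+ + 2 * r) (ℤ.pos-* (𝔼₂ dist i j) (totalDist n)) ⟨
      + (𝔼₂ dist i j ℕ.* totalDist n) + + 2 * r            ≡⟨ cong (λ s → + s + + 2 * r) factor ⟨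
      + Σ[ n ] (𝔼₃ distTimesDistSum₃ i j) + + 2 * r        ≡⟨ Σ-𝔼₃-last-ℤ distTimesDistSum₃ i≢j i≢k j≢k ⟩
      N * r + (+ 𝔼₂ distTimesDistSum i j + + 𝔼₃ distTimesDistSum₃ i j j)
                                                          ≡⟨ cong (λ d → N * r + (+ 𝔼₂ distTimesDistSum i j + + d)) flipped ⟩
      N * r + (+ 𝔼₂ distTimesDistSum i j + + 𝔼₂ distTimesDistSum j i) ∎
      where
      r = + 𝔼₃ distTimesDistSum₃ i j k
      factor : Σ[ n ] (𝔼₃ distTimesDistSum₃ i j) ≡ 𝔼₂ dist i j ℕ.* totalDist n
      factor = trans (Σ-𝔼 {n} (λ π → distTimesDistSum₃ (pos π i) (pos π j)))
        (trans (𝔼-cong (λ {π} _ → ∑-*ˡ (allFin n) (dist (pos π i) (pos π j)) (λ z → distSum n (toℕ z))))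
               (∑-*ʳ (arrangements n) (totalDist n) (λ π → dist (pos π i) (pos π j))))
      flipped : 𝔼₃ distTimesDistSum₃ i j j ≡ 𝔼₂ distTimesDistSum j i
      flipped = 𝔼-cong (λ {π} _ → cong (ℕ._* distSum n (pos π j)) (ℕ.∣-∣-comm (pos π i) (pos π j)))

    𝔼-distTimesDistSum₃ : ∀ {i j k : Fin n} → i ≢ j → i ≢ k → j ≢ k →
      + 180 * + 𝔼₃ distTimesDistSum₃ i j k ≡ + 2 * L * ((N + + 1) * (+ 10 * N * N - N - + 12))
    𝔼-distTimesDistSum₃ {i} {j} {k} i≢j i≢k j≢k = ℤ.*-cancelˡ-≡ (N - + 2) _ _ {{nonZero-N-k (3≤n i≢j i≢k j≢k)}} (begin
      (N - + 2) * (+ 180 * r)                                        ≡⟨ expand N r P P′ ⟩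
      + 180 * (N * r + (P + P′)) - + 360 * r - + 3 * (+ 60 * P) - + 3 * (+ 60 * P′)
        ≡⟨ cong (λ s → + 180 * s - + 360 * r - + 3 * (+ 60 * P) - + 3 * (+ 60 * P′)) (Σ-last-distTimesDistSum₃ i≢j i≢k j≢k) ⟨
      + 180 * (U * A + + 2 * r) - + 360 * r - + 3 * (+ 60 * P) - + 3 * (+ 60 * P′)
        ≡⟨ collect U A r (+ 60 * P) (+ 60 * P′) ⟩
      + 20 * (+ 3 * U) * (+ 3 * A) - + 3 * (+ 60 * P) - + 3 * (+ 60 * P′)
        ≡⟨ cong₂ (λ u a → + 20 * u * a - + 3 * (+ 60 * P) - + 3 * (+ 60 * P′)) (𝔼-dist i≢j) (totalDist-closed n) ⟩
      + 20 * (L * (N + + 1)) * ((N - + 1) * N * (N + + 1)) - + 3 * (+ 60 * P) - + 3 * (+ 60 * P′)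
        ≡⟨ cong₂ (λ p p′ → + 20 * (L * (N + + 1)) * ((N - + 1) * N * (N + + 1)) - + 3 * p - + 3 * p′)
                 (𝔼-distTimesDistSum i≢j) (𝔼-distTimesDistSum (≢-sym i≢j)) ⟩
      + 20 * (L * (N + + 1)) * ((N - + 1) * N * (N + + 1)) - + 3 * (L * ((N + + 1) * (+ 7 * N * N - + 8)))
        - + 3 * (L * ((N + + 1) * (+ 7 * N * N - + 8)))              ≡⟨ factor N L ⟩
      (N - + 2) * (+ 2 * L * ((N + + 1) * (+ 10 * N * N - N - + 12))) ∎)
      where
      r = + 𝔼₃ distTimesDistSum₃ i j k
      U = + 𝔼₂ dist i j
      A = + totalDist n
      P = + 𝔼₂ distTimesDistSum i j
      P′ = + 𝔼₂ distTimesDistSum j i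
      expand : ∀ N r P P′ → (N - + 2) * (+ 180 * r)
                            ≡ + 180 * (N * r + (P + P′)) - + 360 * r - + 3 * (+ 60 * P) - + 3 * (+ 60 * P′)
      expand = solve-∀
      collect : ∀ U A r p p′ → + 180 * (U * A + + 2 * r) - + 360 * r - + 3 * p - + 3 * p′
                               ≡ + 20 * (+ 3 * U) * (+ 3 * A) - + 3 * p - + 3 * p′
      collect = solve-∀
      factor : ∀ N L → + 20 * (L * (N + + 1)) * ((N - + 1) * N * (N + + 1)) - + 3 * (L * ((N + + 1) * (+ 7 * N * N - + 8)))
                       - + 3 * (L * ((N + + 1) * (+ 7 * N * N - + 8)))
                       ≡ (N - + 2) * (+ 2 * L * ((N + + 1) * (+ 10 * N * N - N - + 12)))
      factor = solve-∀

    Σ-last-distPair : ∀ {i j k l : Fin n} → i ≢ j → i ≢ k → j ≢ k → i ≢ l → j ≢ l → k ≢ l →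
      + 𝔼₃ distTimesDistSum₃ i j k + + 3 * + 𝔼₄ distPair i j k l
      ≡ N * + 𝔼₄ distPair i j k l + (+ 𝔼₃ distStar i j k + + 𝔼₃ distStar j i k)
    Σ-last-distPair {i} {j} {k} {l} i≢j i≢k j≢k i≢l j≢l k≢l = begin
      + 𝔼₃ distTimesDistSum₃ i j k + + 3 * q               ≡⟨ cong (λ s → + s + + 3 * q) factor ⟨
      + Σ[ n ] (𝔼₄ distPair i j k) + + 3 * q               ≡⟨ Σ-𝔼₄-last-ℤ distPair i≢j i≢k j≢k i≢l j≢l k≢l ⟩
      N * q + (+ 𝔼₄ distPair i j k i + (+ 𝔼₄ distPair i j k j + + 𝔼₄ distPair i j k k))
        ≡⟨ cong (λ d → N * q + d) (cong₂ (λ a b → + a + b) at-i (cong₂ (λ a b → + a + + b) at-j at-k)) ⟩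
      N * q + (+ 𝔼₃ distStar i j k + (+ 𝔼₃ distStar j i k + + 0))
        ≡⟨ cong (λ d → N * q + (+ 𝔼₃ distStar i j k + d)) (ℤ.+-identityʳ (+ 𝔼₃ distStar j i k)) ⟩
      N * q + (+ 𝔼₃ distStar i j k + + 𝔼₃ distStar j i k) ∎
      where
      q = + 𝔼₄ distPair i j k l
      factor : Σ[ n ] (𝔼₄ distPair i j k) ≡ 𝔼₃ distTimesDistSum₃ i j k
      factor = trans (Σ-𝔼 {n} (λ π → distPair (pos π i) (pos π j) (pos π k)))
        (𝔼-cong (λ {π} _ → ∑-*ˡ (allFin n) (dist (pos π i) (pos π j)) (λ w → dist (pos π k) (toℕ w))))
      at-i : 𝔼₄ distPair i j k i ≡ 𝔼₃ distStar i j k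
      at-i = 𝔼-cong (λ {π} _ → cong (dist (pos π i) (pos π j) ℕ.*_) (ℕ.∣-∣-comm (pos π k) (pos π i)))
      at-j : 𝔼₄ distPair i j k j ≡ 𝔼₃ distStar j i k
      at-j = 𝔼-cong (λ {π} _ → cong₂ ℕ._*_ (ℕ.∣-∣-comm (pos π i) (pos π j)) (ℕ.∣-∣-comm (pos π k) (pos π j)))
      at-k : 𝔼₄ distPair i j k k ≡ 0
      at-k = 𝔼-zero (λ π → trans (cong (dist (pos π i) (pos π j) ℕ.*_) (ℕ.∣n-n∣≡0 (pos π k)))
                                  (ℕ.*-zeroʳ (dist (pos π i) (pos π j))))

    𝔼-distPair : ∀ {i j k l : Fin n} → i ≢ j → i ≢ k → j ≢ k → i ≢ l → j ≢ l → k ≢ l →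
      + 45 * + 𝔼₄ distPair i j k l ≡ L * ((N + + 1) * (+ 5 * N + + 4))
    𝔼-distPair {i} {j} {k} {l} i≢j i≢k j≢k i≢l j≢l k≢l =
      ℤ.*-cancelˡ-≡ (+ 4 * (N - + 3)) _ _ {{ℤ.i*j≢0 (+ 4) (N - + 3) {{_}} {{nonZero-N-k (4≤n i≢j i≢k j≢k i≢l j≢l k≢l)}}}} (begin
      + 4 * (N - + 3) * (+ 45 * q)                                   ≡⟨ expand N q S S′ ⟩
      + 180 * (N * q + (S + S′)) - + 540 * q - + 3 * (+ 60 * S) - + 3 * (+ 60 * S′)
        ≡⟨ cong (λ s → + 180 * s - + 540 * q - + 3 * (+ 60 * S) - + 3 * (+ 60 * S′)) (Σ-last-distPair i≢j i≢k j≢k i≢l j≢l k≢l) ⟨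
      + 180 * (R + + 3 * q) - + 540 * q - + 3 * (+ 60 * S) - + 3 * (+ 60 * S′)
        ≡⟨ collect R q (+ 60 * S) (+ 60 * S′) ⟩
      + 180 * R - + 3 * (+ 60 * S) - + 3 * (+ 60 * S′)
        ≡⟨ cong (λ ρ → ρ - + 3 * (+ 60 * S) - + 3 * (+ 60 * S′)) (𝔼-distTimesDistSum₃ i≢j i≢k j≢k) ⟩
      + 2 * L * ((N + + 1) * (+ 10 * N * N - N - + 12)) - + 3 * (+ 60 * S) - + 3 * (+ 60 * S′)
        ≡⟨ cong₂ (λ s s′ → + 2 * L * ((N + + 1) * (+ 10 * N * N - N - + 12)) - + 3 * s - + 3 * s′)
                 (𝔼-distStar i≢j i≢k j≢k) (𝔼-distStar (≢-sym i≢j) j≢k i≢k) ⟩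
      + 2 * L * ((N + + 1) * (+ 10 * N * N - N - + 12)) - + 3 * (L * ((N + + 1) * (+ 7 * N + + 4)))
        - + 3 * (L * ((N + + 1) * (+ 7 * N + + 4)))                  ≡⟨ factor N L ⟩
      + 4 * (N - + 3) * (L * ((N + + 1) * (+ 5 * N + + 4)))          ∎)
      where
      q = + 𝔼₄ distPair i j k l
      R = + 𝔼₃ distTimesDistSum₃ i j k
      S = + 𝔼₃ distStar i j k
      S′ = + 𝔼₃ distStar j i k
      expand : ∀ N q S S′ → + 4 * (N - + 3) * (+ 45 * q)
                            ≡ + 180 * (N * q + (S + S′)) - + 540 * q - + 3 * (+ 60 * S) - + 3 * (+ 60 * S′)
      expand = solve-∀
      collect : ∀ R q s s′ → + 180 * (R + + 3 * q) - + 540 * q - + 3 * s - + 3 * s′ ≡ + 180 * R - + 3 * s - + 3 * s′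
      collect = solve-∀
      factor : ∀ N L → + 2 * L * ((N + + 1) * (+ 10 * N * N - N - + 12)) - + 3 * (L * ((N + + 1) * (+ 7 * N + + 4)))
                       - + 3 * (L * ((N + + 1) * (+ 7 * N + + 4)))
                       ≡ + 4 * (N - + 3) * (L * ((N + + 1) * (+ 5 * N + + 4)))
      factor = solve-∀

module EdgePairs where

  open import Defs using (SimpleGraph; adj; irrefl; Σ[_]; ind; degree; edgeCount; sumSqDeg)
  open ListSums
  open FinSums
  open import Data.Bool using (true; false; T)
  open import Data.Unit using (tt)
  open import Data.Nat as ℕ using (ℕ; _+_; _*_; _^_; _<ᵇ_)
  import Data.Nat.Properties as ℕ
  open import Data.Nat.Tactic.RingSolver using (solve-∀)
  open import Data.Fin as Fin using (Fin; toℕ)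
  import Data.Fin.Properties as Fin
  open import Data.List using (allFin)
  open import Data.Empty using (⊥-elim)
  open import Relation.Nullary using (¬_)
  open import Relation.Binary.Definitions using (tri<; tri≈; tri>)
  open import Relation.Binary.PropositionalEquality
  open ≡-Reasoning

  ind-<ᵇ : ∀ {a b} → a ℕ.< b → ind (a <ᵇ b) ≡ 1
  ind-<ᵇ {a} {b} a<b with a <ᵇ b | ℕ.<⇒<ᵇ a<b
  ... | true | _ = refl

  ind-≮ᵇ : ∀ {a b} → ¬ a ℕ.< b → ind (a <ᵇ b) ≡ 0
  ind-≮ᵇ {a} {b} a≮b with a <ᵇ b in eq
  ... | true  = ⊥-elim (a≮b (ℕ.<ᵇ⇒< a b (subst T (sym eq) tt)))
  ... | false = refl

  module _ {n : ℕ} where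

    shared : Fin n → Fin n → Fin n → Fin n → ℕ
    shared i j k l = δ k i + δ l i + (δ k j + δ l j)

    same : Fin n → Fin n → Fin n → Fin n → ℕ
    same i j k l = δ k i * δ l j + δ l i * δ k j

  module _ {n : ℕ} (G : SimpleGraph n) where

    edge : Fin n → Fin n → ℕ
    edge i j = ind (toℕ i <ᵇ toℕ j) * ind (adj G i j)

    outDegree inDegree : Fin n → ℕ
    outDegree i = Σ[ n ] (edge i)
    inDegree  i = Σ[ n ] (λ j → edge j i)

    adj-split : ∀ x y → ind (adj G x y) ≡ edge x y + edge y x
    adj-split x y with ℕ.<-cmp (toℕ x) (toℕ y)
    ... | tri< x<y _ y≮x rewrite ind-<ᵇ x<y | ind-≮ᵇ y≮x = sym (trans (ℕ.+-identityʳ _) (ℕ.+-identityʳ _))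
    ... | tri> x≮y _ y<x rewrite ind-<ᵇ y<x | ind-≮ᵇ x≮y = trans (cong ind (SimpleGraph.sym G x y)) (sym (ℕ.+-identityʳ _))
    ... | tri≈ _ x≡y _ with Fin.toℕ-injective x≡y
    ...   | refl rewrite irrefl G x = sym (cong₂ _+_ (ℕ.*-zeroʳ (ind (toℕ x <ᵇ toℕ x))) (ℕ.*-zeroʳ (ind (toℕ x <ᵇ toℕ x))))

    degree-split : ∀ x → degree G x ≡ outDegree x + inDegree x
    degree-split x = trans (∑-cong (allFin n) (adj-split x)) (∑-+ (allFin n) (edge x) (λ y → edge y x))

    edge-idem : ∀ i j → edge i j * edge i j ≡ edge i j
    edge-idem i j with toℕ i <ᵇ toℕ j | adj G i j
    ... | true  | true  = refl
    ... | true  | false = refl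
    ... | false | _     = refl

    edge-antisym : ∀ i j → edge i j * edge j i ≡ 0
    edge-antisym i j with ℕ.<-cmp (toℕ i) (toℕ j)
    ... | tri< _ _ j≮i rewrite ind-≮ᵇ j≮i = ℕ.*-zeroʳ (edge i j)
    ... | tri≈ i≮j _ _ rewrite ind-≮ᵇ i≮j = refl
    ... | tri> i≮j _ _ rewrite ind-≮ᵇ i≮j = refl

    edge-irrefl : ∀ i → edge i i ≡ 0
    edge-irrefl i rewrite ind-≮ᵇ {toℕ i} (ℕ.<-irrefl refl) = refl

    Σ²-edge-incident : ∀ x → Σ² n (λ k l → edge k l * (δ k x + δ l x)) ≡ degree G x
    Σ²-edge-incident x = begin
      Σ² n (λ k l → edge k l * (δ k x + δ l x))
        ≡⟨ ∑-cong (allFin n) (λ k → trans (∑-cong (allFin n) (λ l → ℕ.*-distribˡ-+ (edge k l) _ _)) (∑-+ (allFin n) _ _)) ⟩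
      Σ[ n ] (λ k → Σ[ n ] (λ l → edge k l * δ k x) + Σ[ n ] (λ l → edge k l * δ l x))
        ≡⟨ ∑-+ (allFin n) _ _ ⟩
      Σ² n (λ k l → edge k l * δ k x) + Σ² n (λ k l → edge k l * δ l x)
        ≡⟨ cong₂ _+_ at-tail at-head ⟩
      outDegree x + inDegree x
        ≡⟨ degree-split x ⟨
      degree G x ∎
      where
      at-tail : Σ² n (λ k l → edge k l * δ k x) ≡ outDegree x
      at-tail = trans (∑-cong (allFin n) (λ k → trans (∑-*ʳ (allFin n) (δ k x) (edge k)) (ℕ.*-comm _ (δ k x))))
                      (Σ-δ n x outDegree)
      at-head : Σ² n (λ k l → edge k l * δ l x) ≡ inDegree x
      at-head = ∑-cong (allFin n) (λ k → trans (∑-cong (allFin n) (λ l → ℕ.*-comm (edge k l) (δ l x))) (Σ-δ n x (edge k)))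

    Σ²-edge-same : ∀ i j → Σ² n (λ k l → edge k l * (δ k i * δ l j + δ l i * δ k j)) ≡ edge i j + edge j i
    Σ²-edge-same i j = begin
      Σ² n (λ k l → edge k l * (δ k i * δ l j + δ l i * δ k j))
        ≡⟨ ∑-cong (allFin n) (λ k → trans (∑-cong (allFin n) (λ l → split (edge k l) (δ k i) (δ l j) (δ l i) (δ k j))) (∑-+ (allFin n) _ _)) ⟩
      Σ[ n ] (λ k → Σ[ n ] (λ l → edge k l * (δ k i * δ l j)) + Σ[ n ] (λ l → edge k l * (δ k j * δ l i)))
        ≡⟨ ∑-+ (allFin n) _ _ ⟩
      Σ² n (λ k l → edge k l * (δ k i * δ l j)) + Σ² n (λ k l → edge k l * (δ k j * δ l i))
        ≡⟨ cong₂ _+_ (Σ²-δδ n edge i j) (Σ²-δδ n edge j i) ⟩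
      edge i j + edge j i ∎
      where split : ∀ e a b c d → e * (a * b + c * d) ≡ e * (a * b) + e * (d * c)
            split = solve-∀

    Σ⁴-edgePairs : ∀ (X : Fin n → Fin n → Fin n → Fin n → ℕ) → Σ⁴ n (λ i j k l → edge i j * edge k l * X i j k l)
                         ≡ Σ² n (λ i j → edge i j * Σ² n (λ k l → edge k l * X i j k l))
    Σ⁴-edgePairs X = ∑-cong (allFin n) (λ i → ∑-cong (allFin n) (λ j →
      trans (∑-cong (allFin n) (λ k → ∑-cong (allFin n) (λ l → ℕ.*-assoc (edge i j) (edge k l) _)))
            (Σ²-*ˡ n (edge i j) _)))

    Σ⁴-edgePairs-count : Σ⁴ n (λ i j k l → edge i j * edge k l * 1) ≡ edgeCount G * edgeCount G
    Σ⁴-edgePairs-count = begin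
      Σ⁴ n (λ i j k l → edge i j * edge k l * 1)           ≡⟨ Σ⁴-edgePairs (λ _ _ _ _ → 1) ⟩
      Σ² n (λ i j → edge i j * Σ² n (λ k l → edge k l * 1)) ≡⟨ ∑-cong (allFin n) (λ i → ∑-cong (allFin n) (λ j → cong (edge i j *_) per-edge)) ⟩
      Σ² n (λ i j → edge i j * edgeCount G)                 ≡⟨ ∑-cong (allFin n) (λ i → ∑-*ʳ (allFin n) (edgeCount G) (edge i)) ⟩
      Σ[ n ] (λ i → Σ[ n ] (edge i) * edgeCount G)          ≡⟨ ∑-*ʳ (allFin n) (edgeCount G) _ ⟩
      edgeCount G * edgeCount G                           ∎
      where per-edge = ∑-cong (allFin n) (λ k → ∑-cong (allFin n) (λ l → ℕ.*-identityʳ (edge k l)))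

    Σ⁴-edgePairs-shared : Σ⁴ n (λ i j k l → edge i j * edge k l * shared i j k l) ≡ sumSqDeg G
    Σ⁴-edgePairs-shared = begin
      Σ⁴ n (λ i j k l → edge i j * edge k l * shared i j k l)   ≡⟨ Σ⁴-edgePairs shared ⟩
      Σ² n (λ i j → edge i j * Σ² n (λ k l → edge k l * shared i j k l))
        ≡⟨ ∑-cong (allFin n) (λ i → ∑-cong (allFin n) (λ j → cong (edge i j *_) (incident i j))) ⟩
      Σ² n (λ i j → edge i j * (degree G i + degree G j))
        ≡⟨ ∑-cong (allFin n) (λ i → trans (∑-cong (allFin n) (λ j → ℕ.*-distribˡ-+ (edge i j) _ _)) (∑-+ (allFin n) _ _)) ⟩
      Σ[ n ] (λ i → Σ[ n ] (λ j → edge i j * degree G i) + Σ[ n ] (λ j → edge i j * degree G j))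
        ≡⟨ ∑-+ (allFin n) _ _ ⟩
      Σ² n (λ i j → edge i j * degree G i) + Σ² n (λ i j → edge i j * degree G j)
        ≡⟨ cong₂ _+_ (∑-cong (allFin n) (λ i → ∑-*ʳ (allFin n) (degree G i) (edge i)))
                     (trans (∑-comm (allFin n) (allFin n) _) (∑-cong (allFin n) (λ j → ∑-*ʳ (allFin n) (degree G j) (λ i → edge i j)))) ⟩
      Σ[ n ] (λ x → outDegree x * degree G x) + Σ[ n ] (λ x → inDegree x * degree G x)
        ≡⟨ ∑-+ (allFin n) _ _ ⟨
      Σ[ n ] (λ x → outDegree x * degree G x + inDegree x * degree G x)
        ≡⟨ ∑-cong (allFin n) square ⟩
      sumSqDeg G ∎
      where
      incident : ∀ i j → Σ² n (λ k l → edge k l * shared i j k l) ≡ degree G i + degree G j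
      incident i j = trans (∑-cong (allFin n) (λ k → trans (∑-cong (allFin n) (λ l → ℕ.*-distribˡ-+ (edge k l) _ _))
                                                            (∑-+ (allFin n) _ _)))
                           (trans (∑-+ (allFin n) _ _) (cong₂ _+_ (Σ²-edge-incident i) (Σ²-edge-incident j)))
      square : ∀ x → outDegree x * degree G x + inDegree x * degree G x ≡ degree G x ^ 2
      square x = trans (sym (ℕ.*-distribʳ-+ (degree G x) (outDegree x) (inDegree x)))
                       (trans (cong (_* degree G x) (sym (degree-split x))) (cong (degree G x *_) (sym (ℕ.*-identityʳ _))))

    Σ⁴-edgePairs-same : Σ⁴ n (λ i j k l → edge i j * edge k l * same i j k l) ≡ edgeCount G
    Σ⁴-edgePairs-same = begin
      Σ⁴ n (λ i j k l → edge i j * edge k l * same i j k l)   ≡⟨ Σ⁴-edgePairs same ⟩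
      Σ² n (λ i j → edge i j * Σ² n (λ k l → edge k l * same i j k l))
        ≡⟨ ∑-cong (allFin n) (λ i → ∑-cong (allFin n) (λ j → cong (edge i j *_) (Σ²-edge-same i j))) ⟩
      Σ² n (λ i j → edge i j * (edge i j + edge j i))
        ≡⟨ ∑-cong (allFin n) (λ i → ∑-cong (allFin n) (λ j → collapse i j)) ⟩
      edgeCount G ∎
      where
      collapse : ∀ i j → edge i j * (edge i j + edge j i) ≡ edge i j
      collapse i j = trans (ℕ.*-distribˡ-+ (edge i j) _ _)
                           (trans (cong₂ _+_ (edge-idem i j) (edge-antisym i j)) (ℕ.+-identityʳ _))

module SecondMoment where

  open import Defs hiding (sym)
  open ListSums
  open FinSums
  open Exchangeability
  open DistanceMoments
  open EdgePairs
  open import Data.Nat as ℕ using (ℕ; _+_; _*_; _^_)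
  import Data.Nat.Properties as ℕ
  open import Data.Nat.Tactic.RingSolver using (solve-∀)
  open import Data.Integer as ℤ using (+_)
  import Data.Integer.Properties as ℤ
  open import Data.Fin as Fin using (Fin)
  open import Data.List using (allFin)
  open import Data.Empty using (⊥-elim)
  open import Relation.Nullary using (yes; no)
  open import Relation.Binary.PropositionalEquality
  open ≡-Reasoning

  rescale : ∀ c k Q l x {X} → + x ≡ X → + k ℤ.* + Q ≡ + l ℤ.* X → c * k * Q ≡ c * (l * x)
  rescale c k Q l x {X} emb eq = ℤ.+-injective (begin
    + (c * k * Q)              ≡⟨ cong +_ (ℕ.*-assoc c k Q) ⟩
    + (c * (k * Q))            ≡⟨ ℤ.pos-* c (k * Q) ⟩
    + c ℤ.* + (k * Q)          ≡⟨ cong (+ c ℤ.*_) (ℤ.pos-* k Q) ⟩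
    + c ℤ.* (+ k ℤ.* + Q)      ≡⟨ cong (+ c ℤ.*_) eq ⟩
    + c ℤ.* (+ l ℤ.* X)        ≡⟨ cong (λ y → + c ℤ.* (+ l ℤ.* y)) emb ⟨
    + c ℤ.* (+ l ℤ.* + x)      ≡⟨ cong (+ c ℤ.*_) (ℤ.pos-* l x) ⟨
    + c ℤ.* + (l * x)          ≡⟨ ℤ.pos-* c (l * x) ⟨
    + (c * (l * x))            ∎)

  module _ (n : ℕ) where
    private
      N = + n
      L = #arrangements n

    q₀ q₁ q₂ : ℕ
    q₀ = 4 * (L * ((n + 1) * (5 * n + 4)))
    q₁ = 3 * (L * ((n + 1) * (7 * n + 4)))
    q₂ = 30 * (L * (n * (n + 1)))

    180-𝔼-dist² : ∀ {i j : Fin n} → i ≢ j → 180 * 𝔼₂ dist² i j ≡ q₂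
    180-𝔼-dist² {i} {j} i≢j = rescale 30 6 (𝔼₂ dist² i j) L (n * (n + 1))
      (trans (ℤ.pos-* n (n + 1)) (cong (N ℤ.*_) (ℤ.pos-+ n 1))) (𝔼-dist² n i≢j)

    180-𝔼-distStar : ∀ {i j k : Fin n} → i ≢ j → i ≢ k → j ≢ k → 180 * 𝔼₃ distStar i j k ≡ q₁
    180-𝔼-distStar {i} {j} {k} i≢j i≢k j≢k = rescale 3 60 (𝔼₃ distStar i j k) L ((n + 1) * (7 * n + 4))
      (trans (ℤ.pos-* (n + 1) (7 * n + 4)) (cong₂ ℤ._*_ (ℤ.pos-+ n 1) (trans (ℤ.pos-+ (7 * n) 4) (cong (ℤ._+ + 4) (ℤ.pos-* 7 n)))))
      (𝔼-distStar n i≢j i≢k j≢k)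

    180-𝔼-distPair : ∀ {i j k l : Fin n} → i ≢ j → i ≢ k → j ≢ k → i ≢ l → j ≢ l → k ≢ l →
                     180 * 𝔼₄ distPair i j k l ≡ q₀
    180-𝔼-distPair {i} {j} {k} {l} i≢j i≢k j≢k i≢l j≢l k≢l = rescale 4 45 (𝔼₄ distPair i j k l) L ((n + 1) * (5 * n + 4))
      (trans (ℤ.pos-* (n + 1) (5 * n + 4)) (cong₂ ℤ._*_ (ℤ.pos-+ n 1) (trans (ℤ.pos-+ (5 * n) 4) (cong (ℤ._+ + 4) (ℤ.pos-* 5 n)))))
      (𝔼-distPair n i≢j i≢k j≢k i≢l j≢l k≢l)

    -- The subtraction-free form of 180·Q = q₀ + (q₁ − q₀)·s + (q₂ − 2q₁ + q₀)·t.  For edges (i,j), (k,l)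
    -- with s = shared i j k l and t = same i j k l it holds exactly when 180·Q is q₀, q₁, q₂ for disjoint,
    -- adjacent and equal edges respectively.
    Fits : ℕ → ℕ → ℕ → Set
    Fits Q s t = 180 * Q + q₀ * s + 2 * q₁ * t ≡ q₀ + q₁ * s + (q₂ + q₀) * t

    private
      fits-disjoint : ∀ Q → 180 * Q ≡ q₀ → Fits Q 0 0
      fits-disjoint Q eq = trans (cong (λ z → z + q₀ * 0 + 2 * q₁ * 0) eq) (arith q₀ q₁ q₂)
        where arith : ∀ a b c → a + a * 0 + 2 * b * 0 ≡ a + b * 0 + (c + a) * 0
              arith = solve-∀

      fits-shared : ∀ Q → 180 * Q ≡ q₁ → Fits Q 1 0
      fits-shared Q eq = trans (cong (λ z → z + q₀ * 1 + 2 * q₁ * 0) eq) (arith q₀ q₁ q₂)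
        where arith : ∀ a b c → b + a * 1 + 2 * b * 0 ≡ a + b * 1 + (c + a) * 0
              arith = solve-∀

      fits-same : ∀ Q → 180 * Q ≡ q₂ → Fits Q 2 1
      fits-same Q eq = trans (cong (λ z → z + q₀ * 2 + 2 * q₁ * 1) eq) (arith q₀ q₁ q₂)
        where arith : ∀ a b c → c + a * 2 + 2 * b * 1 ≡ a + b * 2 + (c + a) * 1
              arith = solve-∀

    module _ (Q : Fin n → Fin n → Fin n → Fin n → ℕ)
             (swapˡ : ∀ i j k l → Q i j k l ≡ Q j i k l)
             (swapʳ : ∀ i j k l → Q i j k l ≡ Q i j l k)
             (on-same : ∀ {i j} → i ≢ j → 180 * Q i j i j ≡ q₂)
             (on-shared : ∀ {i j l} → i ≢ j → i ≢ l → j ≢ l → 180 * Q i j i l ≡ q₁)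
             (on-disjoint : ∀ {i j k l} → i ≢ j → i ≢ k → j ≢ k → i ≢ l → j ≢ l → k ≢ l → 180 * Q i j k l ≡ q₀)
             where

      fits-overlap : ∀ i j k l → i ≢ j → k ≢ l → Fits (Q i j k l) (shared i j k l) (same i j k l)
      fits-overlap i j k l i≢j k≢l with k Fin.≟ i | l Fin.≟ i | k Fin.≟ j | l Fin.≟ j
      ... | yes refl | yes refl | _        | _        = ⊥-elim (k≢l refl)
      ... | yes refl | no _     | yes refl | _        = ⊥-elim (i≢j refl)
      ... | yes refl | no _     | no _     | yes refl = fits-same (Q i j i j) (on-same i≢j)
      ... | yes refl | no l≢i   | no _     | no l≢j   = fits-shared (Q i j i l) (on-shared i≢j (≢-sym l≢i) (≢-sym l≢j))
      ... | no _     | yes refl | yes refl | yes refl = ⊥-elim (i≢j refl)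
      ... | no _     | yes refl | yes refl | no _     = fits-same (Q i j j i) (trans (cong (180 *_) (swapʳ i j j i)) (on-same i≢j))
      ... | no _     | yes refl | no _     | yes refl = ⊥-elim (i≢j refl)
      ... | no k≢i   | yes refl | no k≢j   | no _     =
        fits-shared (Q i j k i) (trans (cong (180 *_) (swapʳ i j k i)) (on-shared i≢j (≢-sym k≢i) (≢-sym k≢j)))
      ... | no _     | no _     | yes refl | yes refl = ⊥-elim (k≢l refl)
      ... | no _     | no l≢i   | yes refl | no l≢j   =
        fits-shared (Q i j j l) (trans (cong (180 *_) (swapˡ i j j l)) (on-shared (≢-sym i≢j) (≢-sym l≢j) (≢-sym l≢i)))
      ... | no k≢i   | no _     | no k≢j   | yes refl =
        fits-shared (Q i j k j) (trans (cong (180 *_) (trans (swapˡ i j k j) (swapʳ j i k j))) (on-shared (≢-sym i≢j) (≢-sym k≢j) (≢-sym k≢i)))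
      ... | no k≢i   | no l≢i   | no k≢j   | no l≢j   =
        fits-disjoint (Q i j k l) (on-disjoint i≢j (≢-sym k≢i) (≢-sym k≢j) (≢-sym l≢i) (≢-sym l≢j) k≢l)

    fits-distPair : ∀ (i j k l : Fin n) → i ≢ j → k ≢ l → Fits (𝔼₄ distPair i j k l) (shared i j k l) (same i j k l)
    fits-distPair = fits-overlap (𝔼₄ distPair)
      (λ i j k l → 𝔼-cong (λ {π} _ → cong (_* dist (pos π k) (pos π l)) (ℕ.∣-∣-comm (pos π i) (pos π j))))
      (λ i j k l → 𝔼-cong (λ {π} _ → cong (dist (pos π i) (pos π j) *_) (ℕ.∣-∣-comm (pos π k) (pos π l))))
      180-𝔼-dist² 180-𝔼-distStar 180-𝔼-distPair

  module _ {n} (G : SimpleGraph n) where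

    sumEdgeLengths² : ∀ π → sumEdgeLengths G π ^ 2
      ≡ Σ⁴ n (λ i j k l → edge G i j * edge G k l * distPair (pos π i) (pos π j) (pos π k) (pos π l))
    sumEdgeLengths² π = begin
      D * (D * 1)                                   ≡⟨ cong (D *_) (ℕ.*-identityʳ D) ⟩
      D * D                                         ≡⟨ ∑-*ʳ (allFin n) D (λ i → Σ[ n ] (a i)) ⟨
      Σ[ n ] (λ i → Σ[ n ] (a i) * D)               ≡⟨ ∑-cong (allFin n) (λ i → ∑-*ʳ (allFin n) D (a i)) ⟨
      Σ² n (λ i j → a i j * D)                      ≡⟨ ∑-cong (allFin n) (λ i → ∑-cong (allFin n) (λ j → Σ²-*ˡ n (a i j) a)) ⟨
      Σ⁴ n (λ i j k l → a i j * a k l)              ≡⟨ Σ⁴-cong (λ i j k l → regroup (edge G i j) (dist (pos π i) (pos π j)) (edge G k l) _) ⟩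
      Σ⁴ n (λ i j k l → edge G i j * edge G k l * distPair (pos π i) (pos π j) (pos π k) (pos π l)) ∎
      where
      a : Fin n → Fin n → ℕ
      a i j = edge G i j * dist (pos π i) (pos π j)
      D = sumEdgeLengths G π
      regroup : ∀ e d e′ d′ → e * d * (e′ * d′) ≡ e * e′ * (d * d′)
      regroup = solve-∀

    𝔼-sumEdgeLengths² : 𝔼 (λ π → sumEdgeLengths G π ^ 2) ≡ Σ⁴ n (λ i j k l → edge G i j * edge G k l * 𝔼₄ distPair i j k l)
    𝔼-sumEdgeLengths² = begin
      𝔼 (λ π → sumEdgeLengths G π ^ 2)
        ≡⟨ 𝔼-cong (λ {π} _ → sumEdgeLengths² π) ⟩
      𝔼 (λ π → Σ⁴ n (λ i j k l → edge G i j * edge G k l * distPair (pos π i) (pos π j) (pos π k) (pos π l)))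
        ≡⟨ 𝔼-Σ⁴ (λ π i j k l → edge G i j * edge G k l * distPair (pos π i) (pos π j) (pos π k) (pos π l)) ⟩
      Σ⁴ n (λ i j k l → 𝔼 (λ π → edge G i j * edge G k l * distPair (pos π i) (pos π j) (pos π k) (pos π l)))
        ≡⟨ Σ⁴-cong (λ i j k l → ∑-*ˡ (arrangements n) (edge G i j * edge G k l) _) ⟩
      Σ⁴ n (λ i j k l → edge G i j * edge G k l * 𝔼₄ distPair i j k l) ∎

    private
      weighted : (Fin n → Fin n → Fin n → Fin n → ℕ) → Fin n → Fin n → Fin n → Fin n → ℕ
      weighted X i j k l = edge G i j * edge G k l * X i j k l

      one : Fin n → Fin n → Fin n → Fin n → ℕ
      one _ _ _ _ = 1

      vanish : ∀ Q s t a b c → 180 * (0 * Q) + a * (0 * s) + 2 * b * (0 * t) ≡ a * (0 * 1) + b * (0 * s) + (c + a) * (0 * t)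
      vanish = solve-∀

    weighted-fits : ∀ i j k l →
      180 * weighted (𝔼₄ distPair) i j k l + q₀ n * weighted shared i j k l + 2 * q₁ n * weighted same i j k l
      ≡ q₀ n * weighted one i j k l + q₁ n * weighted shared i j k l + (q₂ n + q₀ n) * weighted same i j k l
    weighted-fits i j k l with i Fin.≟ j | k Fin.≟ l
    ... | yes refl | _ rewrite edge-irrefl G i =
      vanish (𝔼₄ distPair i i k l) (shared i i k l) (same i i k l) (q₀ n) (q₁ n) (q₂ n)
    ... | no _ | yes refl rewrite edge-irrefl G k | ℕ.*-zeroʳ (edge G i j) =
      vanish (𝔼₄ distPair i j k k) (shared i j k k) (same i j k k) (q₀ n) (q₁ n) (q₂ n)
    ... | no i≢j | no k≢l =
      scale (edge G i j * edge G k l) (𝔼₄ distPair i j k l) (shared i j k l) (same i j k l) (q₀ n) (q₁ n) (q₂ n)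
            (fits-distPair n i j k l i≢j k≢l)
      where
      scale : ∀ e Q s t a b c → 180 * Q + a * s + 2 * b * t ≡ a + b * s + (c + a) * t →
              180 * (e * Q) + a * (e * s) + 2 * b * (e * t) ≡ a * (e * 1) + b * (e * s) + (c + a) * (e * t)
      scale e Q s t a b c fits = trans (expand e Q s t a b) (trans (cong (e *_) fits) (collect e s t a b c))
        where
        expand : ∀ e Q s t a b → 180 * (e * Q) + a * (e * s) + 2 * b * (e * t) ≡ e * (180 * Q + a * s + 2 * b * t)
        expand = solve-∀
        collect : ∀ e s t a b c → e * (a + b * s + (c + a) * t) ≡ a * (e * 1) + b * (e * s) + (c + a) * (e * t)
        collect = solve-∀

    summed-fits : let m = edgeCount G; K = sumSqDeg G in
      180 * 𝔼 (λ π → sumEdgeLengths G π ^ 2) + q₀ n * K + 2 * q₁ n * m ≡ q₀ n * (m * m) + q₁ n * K + (q₂ n + q₀ n) * m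
    summed-fits = begin
      180 * 𝔼 (λ π → sumEdgeLengths G π ^ 2) + q₀ n * K + 2 * q₁ n * m
        ≡⟨ cong₂ (λ x y → 180 * x + q₀ n * y + 2 * q₁ n * m) 𝔼-sumEdgeLengths² (sym (Σ⁴-edgePairs-shared G)) ⟩
      180 * Σ⁴ n (weighted (𝔼₄ distPair)) + q₀ n * Σ⁴ n (weighted shared) + 2 * q₁ n * m
        ≡⟨ cong (λ y → 180 * Σ⁴ n (weighted (𝔼₄ distPair)) + q₀ n * Σ⁴ n (weighted shared) + 2 * q₁ n * y) (sym (Σ⁴-edgePairs-same G)) ⟩
      180 * Σ⁴ n (weighted (𝔼₄ distPair)) + q₀ n * Σ⁴ n (weighted shared) + 2 * q₁ n * Σ⁴ n (weighted same)
        ≡⟨ Σ⁴-linear 180 (q₀ n) (2 * q₁ n) (weighted (𝔼₄ distPair)) (weighted shared) (weighted same) ⟨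
      Σ⁴ n (λ i j k l → 180 * weighted (𝔼₄ distPair) i j k l + q₀ n * weighted shared i j k l + 2 * q₁ n * weighted same i j k l)
        ≡⟨ Σ⁴-cong weighted-fits ⟩
      Σ⁴ n (λ i j k l → q₀ n * weighted one i j k l + q₁ n * weighted shared i j k l + (q₂ n + q₀ n) * weighted same i j k l)
        ≡⟨ Σ⁴-linear (q₀ n) (q₁ n) (q₂ n + q₀ n) (weighted one) (weighted shared) (weighted same) ⟩
      q₀ n * Σ⁴ n (weighted one) + q₁ n * Σ⁴ n (weighted shared) + (q₂ n + q₀ n) * Σ⁴ n (weighted same)
        ≡⟨ cong₂ (λ x y → q₀ n * x + q₁ n * y + (q₂ n + q₀ n) * Σ⁴ n (weighted same)) (Σ⁴-edgePairs-count G) (Σ⁴-edgePairs-shared G) ⟩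
      q₀ n * (m * m) + q₁ n * K + (q₂ n + q₀ n) * Σ⁴ n (weighted same)
        ≡⟨ cong (λ y → q₀ n * (m * m) + q₁ n * K + (q₂ n + q₀ n) * y) (Σ⁴-edgePairs-same G) ⟩
      q₀ n * (m * m) + q₁ n * K + (q₂ n + q₀ n) * m ∎
      where
      m = edgeCount G
      K = sumSqDeg G

    𝔼-sumEdgeLengths²-cleared : let m = edgeCount G; K = sumSqDeg G; L = #arrangements n in
      180 * 𝔼 (λ π → sumEdgeLengths G π ^ 2) + L * (n + 1) * (8 * m + 4 * K)
      ≡ L * (n + 1) * (4 * m * (m * (5 * n + 4) + 2 * n) + n * K)
    𝔼-sumEdgeLengths²-cleared = ℕ.+-cancelʳ-≡ (q₀ n * K + 2 * q₁ n * m) _ _ (begin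
      180 * ES + c + (q₀ n * K + 2 * q₁ n * m)      ≡⟨ shuffle (180 * ES) c (q₀ n * K) (2 * q₁ n * m) ⟩
      180 * ES + q₀ n * K + 2 * q₁ n * m + c          ≡⟨ cong (_+ c) (summed-fits) ⟩
      q₀ n * (m * m) + q₁ n * K + (q₂ n + q₀ n) * m + c ≡⟨ polynomial (#arrangements n) n m K ⟩
      d + (q₀ n * K + 2 * q₁ n * m)                   ∎)
      where
      m = edgeCount G
      K = sumSqDeg G
      ES = 𝔼 (λ π → sumEdgeLengths G π ^ 2)
      c = #arrangements n * (n + 1) * (8 * m + 4 * K)
      d = #arrangements n * (n + 1) * (4 * m * (m * (5 * n + 4) + 2 * n) + n * K)
      shuffle : ∀ a b x y → a + b + (x + y) ≡ a + x + y + b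
      shuffle = solve-∀
      polynomial : ∀ L n m K →
        4 * (L * ((n + 1) * (5 * n + 4))) * (m * m) + 3 * (L * ((n + 1) * (7 * n + 4))) * K
          + (30 * (L * (n * (n + 1))) + 4 * (L * ((n + 1) * (5 * n + 4)))) * m + L * (n + 1) * (8 * m + 4 * K)
        ≡ L * (n + 1) * (4 * m * (m * (5 * n + 4) + 2 * n) + n * K)
          + (4 * (L * ((n + 1) * (5 * n + 4))) * K + 2 * (3 * (L * ((n + 1) * (7 * n + 4)))) * m)
      polynomial = solve-∀

module Rationals where

  open import Data.Nat as ℕ using (ℕ; suc)
  import Data.Nat.Properties as ℕ
  open import Data.Integer as ℤ using (+_)
  import Data.Integer.Properties as ℤ
  open import Data.Integer.Tactic.RingSolver using (solve-∀)
  open import Data.Rational as ℚ using (ℚ; _/_; _+_; _*_; _-_; 0ℚ; 1ℚ; toℚᵘ)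
  import Data.Rational.Properties as ℚ
  open import Data.Rational.Unnormalised as ℚᵘ using (mkℚᵘ; *≡*)
  import Data.Rational.Unnormalised.Properties as ℚᵘ
  open import Relation.Nullary.Decidable using (dec⇒maybe)
  open import Tactic.RingSolver.Core.AlmostCommutativeRing using (AlmostCommutativeRing; fromCommutativeRing)
  import Tactic.RingSolver as Ring
  open import Relation.Binary.PropositionalEquality
  open ≡-Reasoning

  private
    toℚᵘ-/ : ∀ a d → toℚᵘ (a / suc d) ℚᵘ.≃ mkℚᵘ a d
    toℚᵘ-/ a d = ℚ.toℚᵘ-fromℚᵘ (mkℚᵘ a d)

    ℚ-ring : AlmostCommutativeRing _ _
    ℚ-ring = fromCommutativeRing ℚ.+-*-commutativeRing (λ x → dec⇒maybe (0ℚ ℚ.≟ x))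

  /1-+ : ∀ a b → (a ℤ.+ b) / 1 ≡ a / 1 + b / 1
  /1-+ a b = ℚ.toℚᵘ-injective (ℚᵘ.≃-trans (toℚᵘ-/ (a ℤ.+ b) 0) (ℚᵘ.≃-sym (ℚᵘ.≃-trans (ℚ.toℚᵘ-homo-+ (a / 1) (b / 1))
    (ℚᵘ.≃-trans (ℚᵘ.+-cong (toℚᵘ-/ a 0) (toℚᵘ-/ b 0)) (*≡* (unit a b))))))
    where unit : ∀ a b → (a ℤ.* + 1 ℤ.+ b ℤ.* + 1) ℤ.* + 1 ≡ (a ℤ.+ b) ℤ.* + 1
          unit = solve-∀

  /1-* : ∀ a b → (a ℤ.* b) / 1 ≡ (a / 1) * (b / 1)
  /1-* a b = ℚ.toℚᵘ-injective (ℚᵘ.≃-trans (toℚᵘ-/ (a ℤ.* b) 0) (ℚᵘ.≃-sym (ℚᵘ.≃-trans (ℚ.toℚᵘ-homo-* (a / 1) (b / 1))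
    (ℚᵘ.*-cong (toℚᵘ-/ a 0) (toℚᵘ-/ b 0)))))

  /-as-* : ∀ a d → a / suc d ≡ (a / 1) * (+ 1 / suc d)
  /-as-* a d = ℚ.toℚᵘ-injective (ℚᵘ.≃-trans (toℚᵘ-/ a d) (ℚᵘ.≃-sym (ℚᵘ.≃-trans (ℚ.toℚᵘ-homo-* (a / 1) (+ 1 / suc d))
    (ℚᵘ.≃-trans (ℚᵘ.*-cong (toℚᵘ-/ a 0) (toℚᵘ-/ (+ 1) d)) (*≡* (trans (unit a (+ suc d)) (cong (λ k → a ℤ.* + suc k) (sym (ℕ.+-identityʳ d)))))))))
    where unit : ∀ a D → a ℤ.* + 1 ℤ.* D ≡ a ℤ.* D
          unit = solve-∀

  ι : ℕ → ℚ
  ι x = + x / 1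

  ι-+ : ∀ a b → ι (a ℕ.+ b) ≡ ι a + ι b
  ι-+ a b = trans (cong (_/ 1) (ℤ.pos-+ a b)) (/1-+ (+ a) (+ b))

  ι-* : ∀ a b → ι (a ℕ.* b) ≡ ι a * ι b
  ι-* a b = trans (cong (_/ 1) (ℤ.pos-* a b)) (/1-* (+ a) (+ b))

  ι-inverse : ∀ l → ι (suc l) * (+ 1 / suc l) ≡ 1ℚ
  ι-inverse l = trans (sym (/-as-* (+ suc l) l)) (ℚ.toℚᵘ-injective
    (ℚᵘ.≃-trans (toℚᵘ-/ (+ suc l) l) (ℚᵘ.≃-trans (*≡* (swap (+ suc l))) (ℚᵘ.≃-sym (toℚᵘ-/ (+ 1) 0)))))
    where swap : ∀ x → x ℤ.* + 1 ≡ + 1 ℤ.* x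
          swap = solve-∀

  module _ (n m K : ℕ) where
    private
      ν = ι n
      μ = ι m
      κ = ι K

    ι-cleared : ∀ E L →
      180 ℕ.* E ℕ.+ L ℕ.* (n ℕ.+ 1) ℕ.* (8 ℕ.* m ℕ.+ 4 ℕ.* K)
        ≡ L ℕ.* (n ℕ.+ 1) ℕ.* (4 ℕ.* m ℕ.* (m ℕ.* (5 ℕ.* n ℕ.+ 4) ℕ.+ 2 ℕ.* n) ℕ.+ n ℕ.* K) →
      ι 180 * ι E + ι L * (ν + ι 1) * (ι 8 * μ + ι 4 * κ)
        ≡ ι L * (ν + ι 1) * (ι 4 * μ * (μ * (ι 5 * ν + ι 4) + ι 2 * ν) + ν * κ)
    ι-cleared E L eq = trans (sym lhs) (trans (cong ι eq) rhs)
      where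
      u = 8 ℕ.* m ℕ.+ 4 ℕ.* K
      w = m ℕ.* (5 ℕ.* n ℕ.+ 4) ℕ.+ 2 ℕ.* n
      ι-L[n+1] = trans (ι-* L (n ℕ.+ 1)) (cong (ι L *_) (ι-+ n 1))
      lhs = trans (ι-+ (180 ℕ.* E) (L ℕ.* (n ℕ.+ 1) ℕ.* u))
              (cong₂ _+_ (ι-* 180 E) (trans (ι-* (L ℕ.* (n ℕ.+ 1)) u)
                (cong₂ _*_ ι-L[n+1] (trans (ι-+ (8 ℕ.* m) (4 ℕ.* K)) (cong₂ _+_ (ι-* 8 m) (ι-* 4 K))))))
      ι-w = trans (ι-+ (m ℕ.* (5 ℕ.* n ℕ.+ 4)) (2 ℕ.* n))
              (cong₂ _+_ (trans (ι-* m (5 ℕ.* n ℕ.+ 4)) (cong (μ *_) (trans (ι-+ (5 ℕ.* n) 4) (cong (_+ ι 4) (ι-* 5 n)))))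
                         (ι-* 2 n))
      rhs = trans (ι-* (L ℕ.* (n ℕ.+ 1)) (4 ℕ.* m ℕ.* w ℕ.+ n ℕ.* K))
              (cong₂ _*_ ι-L[n+1] (trans (ι-+ (4 ℕ.* m ℕ.* w) (n ℕ.* K))
                (cong₂ _+_ (trans (ι-* (4 ℕ.* m) w) (cong₂ _*_ (ι-* 4 m) ι-w)) (ι-* n K))))

    private
      R : ℚ
      R = (ν + ι 1) * (+ 1 / 45) * (μ * (μ * (ν * ι 5 + ι 4) + ι 2 * (ν - ι 1)) + (ν * (+ 1 / 4) - ι 1) * κ)

    ι-solved : ∀ E L →
      ι 180 * ι E + ι L * (ν + ι 1) * (ι 8 * μ + ι 4 * κ)
        ≡ ι L * (ν + ι 1) * (ι 4 * μ * (μ * (ι 5 * ν + ι 4) + ι 2 * ν) + ν * κ) →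
      ι E ≡ ι L * R
    ι-solved E L eq = begin
      ι E                                                              ≡⟨ isolate (ι E) X ⟩
      (+ 1 / 180) * (ι 180 * ι E + X) - (+ 1 / 180) * X               ≡⟨ cong (λ s → (+ 1 / 180) * s - (+ 1 / 180) * X) eq ⟩
      (+ 1 / 180) * (ι L * (ν + ι 1) * Y) - (+ 1 / 180) * X            ≡⟨ collect (ι L) ν μ κ ⟩
      ι L * R                                                          ∎
      where
      X = ι L * (ν + ι 1) * (ι 8 * μ + ι 4 * κ)
      Y = ι 4 * μ * (μ * (ι 5 * ν + ι 4) + ι 2 * ν) + ν * κ
      isolate : ∀ e X → e ≡ (+ 1 / 180) * (ι 180 * e + X) - (+ 1 / 180) * X
      isolate = Ring.solve-∀ ℚ-ring
      collect : ∀ ℓ ν μ κ → (+ 1 / 180) * (ℓ * (ν + ι 1) * (ι 4 * μ * (μ * (ι 5 * ν + ι 4) + ι 2 * ν) + ν * κ))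
                            - (+ 1 / 180) * (ℓ * (ν + ι 1) * (ι 8 * μ + ι 4 * κ))
                            ≡ ℓ * ((ν + ι 1) * (+ 1 / 45) * (μ * (μ * (ν * ι 5 + ι 4) + ι 2 * (ν - ι 1))
                                                            + (ν * (+ 1 / 4) - ι 1) * κ))
      collect = Ring.solve-∀ ℚ-ring

    average-closed : ∀ E {L l} → L ≡ suc l →
      180 ℕ.* E ℕ.+ L ℕ.* (n ℕ.+ 1) ℕ.* (8 ℕ.* m ℕ.+ 4 ℕ.* K)
        ≡ L ℕ.* (n ℕ.+ 1) ℕ.* (4 ℕ.* m ℕ.* (m ℕ.* (5 ℕ.* n ℕ.+ 4) ℕ.+ 2 ℕ.* n) ℕ.+ n ℕ.* K) →
      (+ E) / suc l ≡ ((+ suc n) / 45) * ((μ * (μ * (ν * ι 5 + ι 4) + ι 2 * (ν - ι 1))) + ((+ n / 4) - ι 1) * κ)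
    average-closed E {l = l} refl eq = begin
      (+ E) / suc l                        ≡⟨ /-as-* (+ E) l ⟩
      ι E * (+ 1 / suc l)                  ≡⟨ cong (_* (+ 1 / suc l)) (ι-solved E (suc l) (ι-cleared E (suc l) eq)) ⟩
      ι (suc l) * R * (+ 1 / suc l)        ≡⟨ reorder (ι (suc l)) R (+ 1 / suc l) ⟩
      R * (ι (suc l) * (+ 1 / suc l))      ≡⟨ cong (R *_) (ι-inverse l) ⟩
      R * 1ℚ                               ≡⟨ ℚ.*-identityʳ R ⟩
      R                                    ≡⟨ cong₂ (λ a b → a * (μ * (μ * (ν * ι 5 + ι 4) + ι 2 * (ν - ι 1)) + (b - ι 1) * κ))
                                                    (sym (trans (/-as-* (+ suc n) 44) (cong (_* (+ 1 / 45)) ι-suc)))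
                                                    (sym (/-as-* (+ n) 3)) ⟩
      ((+ suc n) / 45) * ((μ * (μ * (ν * ι 5 + ι 4) + ι 2 * (ν - ι 1))) + ((+ n / 4) - ι 1) * κ) ∎
      where
      ι-suc : ι (suc n) ≡ ν + ι 1
      ι-suc = trans (cong ι (ℕ.+-comm 1 n)) (ι-+ n 1)
      reorder : ∀ a b c → a * b * c ≡ b * (a * c)
      reorder = Ring.solve-∀ ℚ-ring

open import Defs
open Exchangeability
open SecondMoment
open Rationals
open import Data.Nat using (ℕ; suc; _^_)
open import Data.Integer using (+_)
open import Data.Rational using (_/_; _+_; _*_; _-_)
open import Relation.Binary.PropositionalEquality using (_≡_)

import Data.List.Properties as List
open import Data.List using (map; length)
open import Data.Nat.ListAction using (sum)
open import Data.Product using (_,_)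
open import Relation.Binary.PropositionalEquality using (refl; trans)

average-suc : ∀ xs {l} → length xs ≡ suc l → average xs ≡ (+ sum xs) / suc l
average-suc xs eq rewrite eq = refl

mainTheorem5 : (n : ℕ) (G : SimpleGraph n) →
    let m = + edgeCount G
        N = + n
        K = + sumSqDeg G
    in Erla n (λ π → sumEdgeLengths G π ^ 2)
       ≡ ((+ suc n) / 45) *
         ( ((m / 1) * ((m / 1) * ((N / 1) * (+ 5 / 1) + (+ 4 / 1))
                       + (+ 2 / 1) * ((N / 1) - (+ 1 / 1))))
         + ((N / 4) - (+ 1 / 1)) * (K / 1) )
mainTheorem5 n G with arrangements-nonempty n
... | l , L≡1+l = trans
  (average-suc (map D² (arrangements n)) (trans (List.length-map D² (arrangements n)) L≡1+l))
  (average-closed n (edgeCount G) (sumSqDeg G) (𝔼 D²) L≡1+l (𝔼-sumEdgeLengths²-cleared G))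
  where
  D² = λ π → sumEdgeLengths G π ^ 2
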